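{- Let $m\geq 3$ and $n\geq 2$ be integers. Then $$D_n=\left\lfloor\left(\frac{\lfloor e\,(n+m-2)!\rfloor}{(n+m-2)!}+\frac{n+m}{(n+m-1)\,(n+m-1)!}+e^{ -1}\right)n!\right\rfloor-\lfloor e\, n!\rfloor .$$
   Context: $D_n$ denotes the number of derangements of $n$ distinct objects (permutations of an $n$-element set with no fixed point). $\lfloor x\rfloor$ denotes the floor of $x$. -}

module Defs where

open import Data.Nat using (ℕ; zero; suc; _+_; _*_; _∸_; _!)
open import Data.Integer using (ℤ; +_)
open import Data.Rational using (ℚ; 0ℚ; 1ℚ; _/_; _<_; _≤_) renaming (_+_ to _+ℚ_; _*_ to _*ℚ_; _-_ to _-ℚ_)
open import Data.Fin using (Fin)
open import Data.Fin.Properties using (all?)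
open import Data.Vec using (Vec; []; _∷_; lookup; toList)
open import Data.List using (List; [_]; concatMap; map; filter; length)
open import Data.List.Relation.Unary.Unique.Propositional using (Unique)
open import Data.List.Relation.Unary.Unique.DecPropositional using (unique?)
open import Data.Product using (Σ; ∃; _×_)
open import Relation.Nullary using (¬_; Dec)
open import Relation.Nullary.Decidable using (_×-dec_; ¬?)
open import Relation.Binary.PropositionalEquality using (_≡_)
import Data.Fin as F
open import Data.List using () renaming (allFin to allFinL)

-- A permutation of Fin n is represented by its table of values
-- v : Vec (Fin n) n (v maps i to lookup v i); such a table is a
-- permutation iff its entries are pairwise distinct (an injective
-- endofunction of a finite set).

allVecs : (n k : ℕ) → List (Vec (Fin n) k)
allVecs n zero    = [ [] ]
allVecs n (suc k) = concatMap (λ i → map (i ∷_) (allVecs n k)) (allFinL n)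

IsDerangement : ∀ {n} → Vec (Fin n) n → Set
IsDerangement {n} v = Unique (toList v) × (∀ (i : Fin n) → ¬ (lookup v i ≡ i))

isDerangement? : ∀ {n} (v : Vec (Fin n) n) → Dec (IsDerangement v)
isDerangement? {n} v = unique? F._≟_ (toList v) ×-dec all? (λ i → ¬? (lookup v i F.≟ i))

D : ℕ → ℕ
D n = length (filter isDerangement? (allVecs n n))

-- Rational p / d for a positive natural d (d = 0 is never used; it is
-- sent to 0 only to make the function total).

div : ℤ → ℕ → ℚ
div p zero    = 0ℚ
div p (suc d) = p / suc d

S : ℕ → ℚ
S zero    = 1ℚ
S (suc K) = S K +ℚ div (+ 1) (suc K !)

-- e is the real number sup_K S K (the limit of the increasing sequence S).
-- Comparisons of rationals with real numbers built from e, for c > 0: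

-- c · e < q
MulELt : ℚ → ℚ → Set
MulELt c q = Σ ℚ λ ε → (0ℚ < ε) × (∀ K → S K *ℚ c +ℚ ε ≤ q)

-- a = ⌊ c · e ⌋   (a ≤ c·e, i.e. ¬ (c·e < a), and c·e < a + 1)
IsFloorMulE : ℚ → ℤ → Set
IsFloorMulE c a = ¬ MulELt c (a / 1) × MulELt c ((a Data.Integer.+ + 1) / 1)

-- (A + e⁻¹) · c < q,  for c > 0.  Writing t = q - A·c this says
-- c / e < t, i.e. 0 < t and c < e · t.
AffEinvLt : ℚ → ℚ → ℚ → Set
AffEinvLt A c q = (0ℚ < t) × ∃ λ K → c < S K *ℚ t
  where t = q -ℚ A *ℚ c

-- z = ⌊ (A + e⁻¹) · c ⌋
IsFloorAffEinv : ℚ → ℚ → ℤ → Set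
IsFloorAffEinv A c z = ¬ AffEinvLt A c (z / 1) × AffEinvLt A c ((z Data.Integer.+ + 1) / 1)

-- The rational part  ⌊e N!⌋ / N! + (n+m) / ((n+m-1) (n+m-1)!)  with N = n+m-2,
-- given a = ⌊e N!⌋.
Apart : ℕ → ℕ → ℤ → ℚ
Apart n m a = div a ((n + m ∸ 2) !) +ℚ div (+ (n + m)) ((n + m ∸ 1) * (n + m ∸ 1) !)

{-# OPTIONS --safe #-}
module Submission where

-- Counting injections that avoid a forbidden value in each position, with a varying set of
-- available values, gives D (r + 2) = (r + 1) (D (r + 1) + D r); hence T n = D n / n! is the
-- n-th partial sum of Σ (-1)^i / i!, and the Cauchy product of T with Σ 1 / j! is identically 1.
-- Since e and 1/e exist only through the partial sums S K, every estimate is proved for all of them: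
-- S K ≤ eUpper M = S (M + 1) + 1 / ((M + 1) (M + 1)!), and the alternating-series bound
-- |T (m + L) - T m| ≤ 1 / (m + 1)! pushed through the Cauchy product gives
-- T m - 1 / (m + 1)! ≤ 1/e ≤ T m + 1 / (m + 1)!.  For N ≥ 2 this yields ⌊e N!⌋ = Σ_{j ≤ N} N! / j!,
-- with which the rational part of the formula is exactly eUpper (n + m - 2).  Finally
-- (eUpper N + 1/e) n! - D n - ⌊e n!⌋ = n! (1/e - T n) + (eUpper N n! - ⌊e n!⌋) lies in
-- [- 1/(n+1) + 1/(n+1), 1/(n+1) + 1/(n+1) + 1/(n+1)²] ⊆ [0, 1) when N ≥ n ≥ 2.

open import Defs

module DerangementRecurrence where

  open import Data.Bool.Base using (Bool; true; false; _∧_; _∨_; not; if_then_else_)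
  open import Data.Bool.Properties using (∧-zeroʳ; ∧-identityʳ; ∧-assoc)
  open import Data.Empty using (⊥-elim)
  open import Data.Fin.Base using (Fin; zero; suc)
  open import Data.Fin.Properties using () renaming (suc-injective to Fin-suc-injective)
  open import Data.List.Base using (List; []; _∷_; _++_; map; concatMap; filter; length)
  import Data.List.Base as List
  open import Data.List.Relation.Unary.All as All using (All; []; _∷_)
  open import Data.List.Relation.Unary.AllPairs using ([]; _∷_)
  open import Data.List.Relation.Unary.Unique.Propositional using (Unique)
  open import Data.Nat.Base using (ℕ; zero; suc; pred; _+_; _*_; _≤_; z≤n; s≤s; _!)
  open import Data.Nat.Properties
  open import Data.Nat.Solver using (module +-*-Solver)
  open +-*-Solver using (solve; _:+_; _:*_; _:=_; con)
  open import Algebra.Properties.Semiring.Sum +-*-semiring using (sum; sum-cong-≗; ∑-distrib-+; *-distribʳ-sum)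
  open import Data.Product using (Σ; _×_; _,_; proj₁; proj₂)
  open import Data.Unit using (⊤; tt)
  open import Data.Vec.Base using (Vec; []; _∷_; lookup; toList; tabulate; allFin)
  open import Data.Vec.Properties using (lookup-allFin)
  open import Function using (_∘_; id)
  open import Function.Definitions using (Injective)
  open import Relation.Binary.PropositionalEquality
  open import Relation.Nullary using (¬_; yes; no)
  open import Level using (0ℓ)
  open import Relation.Unary using (Pred; Decidable)

  -- avoiders s r is the number of permutations of s + r points that fix
  -- none of r prescribed points; derangements are the case s = 0.
  avoiders : ℕ → ℕ → ℕ
  avoiders s 0 = s !
  avoiders s 1 = s * s !
  avoiders s (suc (suc r)) = suc r * avoiders (suc s) r + s * avoiders s (suc r)

  avoiders-pascal : ∀ s r → avoiders (suc s) r ≡ avoiders s (suc r) + avoiders s r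
  avoiders-pascal s zero = +-comm (s !) (s * s !)
  avoiders-pascal s (suc zero) =
    solve 2 (λ s x → (con 1 :+ s) :* ((con 1 :+ s) :* x) := (con 1 :* ((con 1 :+ s) :* x) :+ s :* (s :* x)) :+ s :* x)
      refl s (s !)
  avoiders-pascal s (suc (suc r)) = begin
    suc r * avoiders (suc (suc s)) r + suc s * avoiders (suc s) (suc r)
      ≡⟨ cong₂ (λ x y → suc r * x + suc s * y)
           (trans (avoiders-pascal (suc s) r) (cong (_+ avoiders (suc s) r) (avoiders-pascal s (suc r))))
           (avoiders-pascal s (suc r)) ⟩
    suc r * ((b + c) + a) + suc s * (b + c)
      ≡⟨ solve 4 (λ r s a c → let b = (con 1 :+ r) :* a :+ s :* c in
                 (con 1 :+ r) :* ((b :+ c) :+ a) :+ (con 1 :+ s) :* (b :+ c)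
                   := (con 2 :+ r) :* (b :+ c) :+ s :* b :+ b)
           refl r s a c ⟩
    suc (suc r) * (b + c) + s * b + b
      ≡⟨ cong (λ x → suc (suc r) * x + s * b + b) (sym (avoiders-pascal s (suc r))) ⟩
    avoiders s (suc (suc (suc r))) + avoiders s (suc (suc r)) ∎
    where
    open ≡-Reasoning
    a = avoiders (suc s) r
    c = avoiders s (suc r)
    b = suc r * a + s * c

  avoiders-sucʳ : ∀ s r → avoiders s (suc r) ≡ r * avoiders (suc s) (pred r) + s * avoiders s r
  avoiders-sucʳ s zero    = refl
  avoiders-sucʳ s (suc r) = refl

  avoiders-sucˡ : ∀ s r → avoiders (suc s) r ≡ r * avoiders (suc s) (pred r) + suc s * avoiders s r
  avoiders-sucˡ s zero    = refl
  avoiders-sucˡ s (suc r) = begin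
    avoiders (suc s) (suc r)                                 ≡⟨ avoiders-pascal s (suc r) ⟩
    avoiders s (suc (suc r)) + avoiders s (suc r)            ≡⟨ +-assoc (suc r * a) (s * b) b ⟩
    suc r * a + (s * b + b)                                  ≡⟨ cong (suc r * a +_) (+-comm (s * b) b) ⟩
    suc r * a + suc s * b                                    ∎
    where
    open ≡-Reasoning
    a = avoiders (suc s) r
    b = avoiders s (suc r)

  avoiders-derangement-rec : ∀ r → avoiders 0 (suc (suc r)) ≡ suc r * (avoiders 0 (suc r) + avoiders 0 r)
  avoiders-derangement-rec r = trans (+-identityʳ _) (cong (suc r *_) (avoiders-pascal 0 r))

  infix 4 _==_
  _==_ : ∀ {n} → Fin n → Fin n → Bool
  zero  == zero  = true
  zero  == suc _ = false
  suc _ == zero  = false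
  suc i == suc j = i == j

  ==-refl : ∀ {n} (i : Fin n) → (i == i) ≡ true
  ==-refl zero    = refl
  ==-refl (suc i) = ==-refl i

  ==⇒≡ : ∀ {n} {i j : Fin n} → (i == j) ≡ true → i ≡ j
  ==⇒≡ {i = zero}  {zero}  _ = refl
  ==⇒≡ {i = suc i} {suc j} e = cong suc (==⇒≡ e)

  ==-sym : ∀ {n} (i j : Fin n) → (i == j) ≡ (j == i)
  ==-sym zero    zero    = refl
  ==-sym zero    (suc j) = refl
  ==-sym (suc i) zero    = refl
  ==-sym (suc i) (suc j) = ==-sym i j

  ≢⇒==-false : ∀ {n} {i j : Fin n} → i ≢ j → (i == j) ≡ false
  ≢⇒==-false {i = i} {j} i≢j with i == j in eq
  ... | false = refl
  ... | true  = ⊥-elim (i≢j (==⇒≡ eq))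

  ==-false⇒≢ : ∀ {n} {i j : Fin n} → (i == j) ≡ false → i ≢ j
  ==-false⇒≢ {i = i} eq refl with () ← trans (sym (==-refl i)) eq

  toℕ : Bool → ℕ
  toℕ true  = 1
  toℕ false = 0

  size : ∀ {n} → (Fin n → Bool) → ℕ
  size A = sum (toℕ ∘ A)

  _without_ : ∀ {n} → (Fin n → Bool) → Fin n → (Fin n → Bool)
  (A without x) j = A j ∧ not (j == x)

  _∈ᵇ_ : ∀ {n k} → Fin n → Vec (Fin n) k → Bool
  x ∈ᵇ []      = false
  x ∈ᵇ (f ∷ F) = (x == f) ∨ (x ∈ᵇ F)

  Distinct : ∀ {n k} → Vec (Fin n) k → Set
  Distinct []      = ⊤
  Distinct (f ∷ F) = (f ∈ᵇ F) ≡ false × Distinct F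

  hits : ∀ {n k} → (Fin n → Bool) → Vec (Fin n) k → ℕ
  hits A []      = 0
  hits A (f ∷ F) = toℕ (A f) + hits A F

  size-cong : ∀ {n} {A B : Fin n → Bool} → (∀ i → A i ≡ B i) → size A ≡ size B
  size-cong A≗B = sum-cong-≗ (cong toℕ ∘ A≗B)

  size-none : ∀ {n} (A : Fin n → Bool) → (∀ i → A i ≡ false) → size A ≡ 0
  size-none {zero}  A none = refl
  size-none {suc n} A none rewrite none zero = size-none (A ∘ suc) (none ∘ suc)

  size-all : ∀ n → size {n} (λ _ → true) ≡ n
  size-all zero    = refl
  size-all (suc n) = cong suc (size-all n)

  size-split : ∀ {n} (A B : Fin n → Bool) → size A ≡ size (λ i → A i ∧ B i) + size (λ i → A i ∧ not (B i))
  size-split {n} A B = trans (sum-cong-≗ (λ i → split (A i) (B i))) (∑-distrib-+ {n} _ _)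
    where
    split : ∀ a b → toℕ a ≡ toℕ (a ∧ b) + toℕ (a ∧ not b)
    split false b     = refl
    split true  false = refl
    split true  true  = refl

  size-disjoint-∨ : ∀ {n} (A B C : Fin n → Bool) → (∀ i → (B i ∧ C i) ≡ false) →
    size (λ i → A i ∧ (B i ∨ C i)) ≡ size (λ i → A i ∧ B i) + size (λ i → A i ∧ C i)
  size-disjoint-∨ {n} A B C disjoint = trans (sum-cong-≗ (λ i → split (A i) (B i) (C i) (disjoint i))) (∑-distrib-+ {n} _ _)
    where
    split : ∀ a b c → (b ∧ c) ≡ false → toℕ (a ∧ (b ∨ c)) ≡ toℕ (a ∧ b) + toℕ (a ∧ c)
    split false b     c     _ = refl
    split true  false c     _ = refl
    split true  true  false _ = refl

  size-singleton : ∀ {n} (A : Fin n → Bool) (x : Fin n) → size (λ i → A i ∧ (i == x)) ≡ toℕ (A x)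
  size-singleton A zero rewrite ∧-identityʳ (A zero) =
    trans (cong (toℕ (A zero) +_) (size-none _ (λ i → ∧-zeroʳ (A (suc i))))) (+-identityʳ _)
  size-singleton A (suc x) rewrite ∧-zeroʳ (A zero) = size-singleton (A ∘ suc) x

  size-without : ∀ {n} (A : Fin n → Bool) {x} → A x ≡ true → size A ≡ suc (size (A without x))
  size-without A {x} Ax = trans (size-split A (_== x))
    (cong (_+ size (A without x)) (trans (size-singleton A x) (cong toℕ Ax)))

  size-∈ᵇ : ∀ {n k} (A : Fin n → Bool) (F : Vec (Fin n) k) → Distinct F → size (λ i → A i ∧ (i ∈ᵇ F)) ≡ hits A F
  size-∈ᵇ A []      _ = size-none _ (λ i → ∧-zeroʳ (A i))
  size-∈ᵇ A (f ∷ F) (f∉F , distinct) =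
    trans (size-disjoint-∨ A (_== f) (_∈ᵇ F) disjoint)
          (cong₂ _+_ (size-singleton A f) (size-∈ᵇ A F distinct))
    where
    disjoint : ∀ i → ((i == f) ∧ (i ∈ᵇ F)) ≡ false
    disjoint i with i == f in eq
    ... | false = refl
    ... | true = subst (λ y → (y ∈ᵇ F) ≡ false) (sym (==⇒≡ eq)) f∉F

  hits-without : ∀ {n k} (A : Fin n → Bool) (F : Vec (Fin n) k) → Distinct F → ∀ x →
    hits A F ≡ toℕ (A x ∧ (x ∈ᵇ F)) + hits (A without x) F
  hits-without A []      _ x rewrite ∧-zeroʳ (A x) = refl
  hits-without A (f ∷ F) (f∉F , distinct) x with x == f in eq
  ... | true with refl ← ==⇒≡ {i = x} {f} eq
    rewrite ==-refl f | ∧-identityʳ (A f) | ∧-zeroʳ (A f) | hits-without A F distinct f | f∉F | ∧-zeroʳ (A f) = refl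
  ... | false rewrite ==-sym f x | eq | ∧-identityʳ (A f) | hits-without A F distinct x =
    solve 3 (λ a b c → a :+ (b :+ c) := b :+ (a :+ c)) refl (toℕ (A f)) (toℕ (A x ∧ (x ∈ᵇ F))) (hits (A without x) F)

  hits≤length : ∀ {n k} (A : Fin n → Bool) (F : Vec (Fin n) k) → hits A F ≤ k
  hits≤length A []      = z≤n
  hits≤length A (f ∷ F) with A f
  ... | true  = s≤s (hits≤length A F)
  ... | false = m≤n⇒m≤1+n (hits≤length A F)

  count : ∀ {X : Set} → (X → Bool) → List X → ℕ
  count p []       = 0
  count p (x ∷ xs) = if p x then suc (count p xs) else count p xs

  count-++ : ∀ {X : Set} (p : X → Bool) xs ys → count p (xs ++ ys) ≡ count p xs + count p ys
  count-++ p []       ys = refl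
  count-++ p (x ∷ xs) ys with p x
  ... | true  = cong suc (count-++ p xs ys)
  ... | false = count-++ p xs ys

  count-map : ∀ {X Y : Set} (p : X → Bool) (g : Y → X) xs → count p (map g xs) ≡ count (p ∘ g) xs
  count-map p g []       = refl
  count-map p g (x ∷ xs) with p (g x)
  ... | true  = cong suc (count-map p g xs)
  ... | false = count-map p g xs

  count-concatMap-tabulate : ∀ {X Y : Set} (p : X → Bool) n (g : Fin n → Y) (h : Y → List X) →
    count p (concatMap h (List.tabulate g)) ≡ sum (λ i → count p (h (g i)))
  count-concatMap-tabulate p zero    g h = refl
  count-concatMap-tabulate p (suc n) g h =
    trans (count-++ p (h (g zero)) _) (cong (count p (h (g zero)) +_) (count-concatMap-tabulate p n (g ∘ suc) h))

  count-∧ˡ : ∀ {X : Set} b (p : X → Bool) xs → count (λ x → b ∧ p x) xs ≡ toℕ b * count p xs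
  count-∧ˡ true  p xs       = sym (+-identityʳ _)
  count-∧ˡ false p []       = refl
  count-∧ˡ false p (x ∷ xs) = count-∧ˡ false p xs

  length-filter≡count : ∀ {X : Set} {P : Pred X 0ℓ} (P? : Decidable P) (p : X → Bool) →
    (∀ x → P x → p x ≡ true) → (∀ x → p x ≡ true → P x) → ∀ xs → length (filter P? xs) ≡ count p xs
  length-filter≡count P? p P⇒p p⇒P []       = refl
  length-filter≡count P? p P⇒p p⇒P (x ∷ xs) with P? x | p x in px
  ... | yes Px | true  = cong suc (length-filter≡count P? p P⇒p p⇒P xs)
  ... | yes Px | false with () ← trans (sym (P⇒p x Px)) px
  ... | no ¬Px | true  = ⊥-elim (¬Px (p⇒P x px))
  ... | no ¬Px | false = length-filter≡count P? p P⇒p p⇒P xs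

  admissible : ∀ {n k} → Vec (Fin n) k → (Fin n → Bool) → Vec (Fin n) k → Bool
  admissible []      A []      = true
  admissible (f ∷ F) A (x ∷ w) = A x ∧ (not (x == f) ∧ admissible F (A without x) w)

  admissibleCount : ∀ {n k} → Vec (Fin n) k → (Fin n → Bool) → ℕ
  admissibleCount {n} {k} F A = count (admissible F A) (allVecs n k)

  admissibleCount-∷ : ∀ {n k} f (F : Vec (Fin n) k) A →
    admissibleCount (f ∷ F) A ≡ sum (λ i → toℕ (A i) * (toℕ (not (i == f)) * admissibleCount F (A without i)))
  admissibleCount-∷ {n} {k} f F A =
    trans (count-concatMap-tabulate (admissible (f ∷ F) A) n id (λ i → map (i ∷_) (allVecs n k)))
          (sum-cong-≗ λ i → begin
             count (admissible (f ∷ F) A) (map (i ∷_) (allVecs n k))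
               ≡⟨ count-map (admissible (f ∷ F) A) (i ∷_) (allVecs n k) ⟩
             count (λ w → A i ∧ (not (i == f) ∧ admissible F (A without i) w)) (allVecs n k)
               ≡⟨ count-∧ˡ (A i) _ (allVecs n k) ⟩
             toℕ (A i) * count (λ w → not (i == f) ∧ admissible F (A without i) w) (allVecs n k)
               ≡⟨ cong (toℕ (A i) *_) (count-∧ˡ (not (i == f)) _ (allVecs n k)) ⟩
             toℕ (A i) * (toℕ (not (i == f)) * admissibleCount F (A without i)) ∎)
    where open ≡-Reasoning

  -- When size A = k the admissible vectors are bijections from the positions onto A, and exactly
  -- hits A F of the values they must avoid are available: a permutation problem of type avoiders.
  CountsAvoiders : ∀ {n k} → Vec (Fin n) k → Set
  CountsAvoiders {n} {k} F = ∀ (A : Fin n → Bool) s r →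
    size A ≡ s + r → hits A F ≡ r → k ≡ s + r → admissibleCount F A ≡ avoiders s r

  admissibleCount-without : ∀ {n k} (F : Vec (Fin n) k) A → Distinct F → CountsAvoiders F →
    ∀ a → k ≡ a + hits A F → size A ≡ suc k → ∀ {x} → A x ≡ true →
    admissibleCount F (A without x) ≡ (if x ∈ᵇ F then avoiders (suc a) (pred (hits A F)) else avoiders a (hits A F))
  admissibleCount-without F A distinct counts a k≡ size≡ {x} Ax with x ∈ᵇ F in x∈F
  ... | true rewrite hits-without A F distinct x | Ax | x∈F =
    counts (A without x) (suc a) (hits (A without x) F) size′ refl (trans k≡ (+-suc a _))
    where
    size′ : size (A without x) ≡ suc a + hits (A without x) F
    size′ = trans (suc-injective (trans (sym (size-without A Ax)) size≡)) (trans k≡ (+-suc a _))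
  ... | false = counts (A without x) a (hits A F) size′ hits′ k≡
    where
    size′ : size (A without x) ≡ a + hits A F
    size′ = trans (suc-injective (trans (sym (size-without A Ax)) size≡)) k≡
    hits′ : hits (A without x) F ≡ hits A F
    hits′ = sym (trans (hits-without A F distinct x) (cong₂ (λ a b → toℕ (a ∧ b) + hits (A without x) F) Ax x∈F))

  if≡indicators : ∀ m (X Y : ℕ) → (if m then X else Y) ≡ toℕ m * X + toℕ (not m) * Y
  if≡indicators true  X Y = sym (trans (+-identityʳ _) (*-identityˡ X))
  if≡indicators false X Y = sym (*-identityˡ Y)

  indicators-∧ : ∀ a b m {C} X Y → (a ≡ true → C ≡ (if m then X else Y)) →
    toℕ a * (toℕ b * C) ≡ toℕ (a ∧ (b ∧ m)) * X + toℕ (a ∧ (b ∧ not m)) * Y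
  indicators-∧ false b     m X Y _ = refl
  indicators-∧ true  false m X Y _ = refl
  indicators-∧ true  true  m X Y C≡ =
    trans (*-identityˡ _) (trans (*-identityˡ _) (trans (C≡ refl) (if≡indicators m X Y)))

  sum-indicators : ∀ {n} (P Q : Fin n → Bool) X Y →
    sum (λ i → toℕ (P i) * X + toℕ (Q i) * Y) ≡ size P * X + size Q * Y
  sum-indicators {n} P Q X Y = trans (∑-distrib-+ {n} _ _)
    (cong₂ _+_ (sym (*-distribʳ-sum X (toℕ ∘ P))) (sym (*-distribʳ-sum Y (toℕ ∘ Q))))

  fresh : ∀ {n k} → Fin n → Vec (Fin n) k → (Fin n → Bool) → ℕ
  fresh f F A = size (λ i → A i ∧ (not (i == f) ∧ not (i ∈ᵇ F)))

  size-forbidden-later : ∀ {n k} f (F : Vec (Fin n) k) A → (f ∈ᵇ F) ≡ false → Distinct F →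
    size (λ i → A i ∧ (not (i == f) ∧ (i ∈ᵇ F))) ≡ hits A F
  size-forbidden-later f F A f∉F distinct = trans (size-cong drop-≢f) (size-∈ᵇ A F distinct)
    where
    drop-≢f : ∀ i → (A i ∧ (not (i == f) ∧ (i ∈ᵇ F))) ≡ (A i ∧ (i ∈ᵇ F))
    drop-≢f i with i == f in eq
    ... | false = refl
    ... | true  = cong (A i ∧_) (sym (subst (λ y → (y ∈ᵇ F) ≡ false) (sym (==⇒≡ eq)) f∉F))

  size-decompose : ∀ {n k} f (F : Vec (Fin n) k) A → (f ∈ᵇ F) ≡ false → Distinct F →
    size A ≡ toℕ (A f) + (hits A F + fresh f F A)
  size-decompose f F A f∉F distinct = trans (size-split A (_== f)) (cong₂ _+_ (size-singleton A f) (begin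
    size (λ i → A i ∧ not (i == f))
      ≡⟨ size-split (λ i → A i ∧ not (i == f)) (_∈ᵇ F) ⟩
    size (λ i → (A i ∧ not (i == f)) ∧ (i ∈ᵇ F)) + size (λ i → (A i ∧ not (i == f)) ∧ not (i ∈ᵇ F))
      ≡⟨ cong₂ _+_ (size-cong (λ i → ∧-assoc (A i) _ _)) (size-cong (λ i → ∧-assoc (A i) _ _)) ⟩
    size (λ i → A i ∧ (not (i == f) ∧ (i ∈ᵇ F))) + fresh f F A
      ≡⟨ cong (_+ fresh f F A) (size-forbidden-later f F A f∉F distinct) ⟩
    hits A F + fresh f F A ∎))
    where open ≡-Reasoning

  admissibleCount-choose : ∀ {n k} f (F : Vec (Fin n) k) A → (f ∈ᵇ F) ≡ false → Distinct F → CountsAvoiders F →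
    ∀ a → k ≡ a + hits A F → size A ≡ suc k →
    admissibleCount (f ∷ F) A ≡ hits A F * avoiders (suc a) (pred (hits A F)) + fresh f F A * avoiders a (hits A F)
  admissibleCount-choose f F A f∉F distinct counts a k≡ size≡ = begin
    admissibleCount (f ∷ F) A
      ≡⟨ admissibleCount-∷ f F A ⟩
    sum (λ i → toℕ (A i) * (toℕ (not (i == f)) * admissibleCount F (A without i)))
      ≡⟨ sum-cong-≗ (λ i → indicators-∧ (A i) (not (i == f)) (i ∈ᵇ F) X Y
                             (admissibleCount-without F A distinct counts a k≡ size≡)) ⟩
    sum (λ i → toℕ (A i ∧ (not (i == f) ∧ (i ∈ᵇ F))) * X + toℕ (A i ∧ (not (i == f) ∧ not (i ∈ᵇ F))) * Y)
      ≡⟨ sum-indicators (λ i → A i ∧ (not (i == f) ∧ (i ∈ᵇ F))) (λ i → A i ∧ (not (i == f) ∧ not (i ∈ᵇ F))) X Y ⟩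
    size (λ i → A i ∧ (not (i == f) ∧ (i ∈ᵇ F))) * X + fresh f F A * Y
      ≡⟨ cong (λ c → c * X + fresh f F A * Y) (size-forbidden-later f F A f∉F distinct) ⟩
    hits A F * X + fresh f F A * Y ∎
    where
    open ≡-Reasoning
    X = avoiders (suc a) (pred (hits A F))
    Y = avoiders a (hits A F)

  countsAvoiders-∷ : ∀ {n k} f (F : Vec (Fin n) k) → (f ∈ᵇ F) ≡ false → Distinct F →
    CountsAvoiders F → CountsAvoiders (f ∷ F)
  countsAvoiders-∷ {k = k} f F f∉F distinct counts A s r size≡ hits≡ k≡ with A f in Af
  ... | true = begin
    admissibleCount (f ∷ F) A
      ≡⟨ admissibleCount-choose f F A f∉F distinct counts s k≡′ (trans size≡ (sym k≡)) ⟩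
    r′ * avoiders (suc s) (pred r′) + fresh f F A * avoiders s r′
      ≡⟨ cong (λ c → r′ * avoiders (suc s) (pred r′) + c * avoiders s r′) fresh≡ ⟩
    r′ * avoiders (suc s) (pred r′) + s * avoiders s r′
      ≡⟨ sym (avoiders-sucʳ s r′) ⟩
    avoiders s (suc r′)
      ≡⟨ cong (avoiders s) hits≡ ⟩
    avoiders s r ∎
    where
    open ≡-Reasoning
    r′ = hits A F
    k≡′ : k ≡ s + r′
    k≡′ = suc-injective (trans k≡ (trans (cong (s +_) (sym hits≡)) (+-suc s r′)))
    fresh≡ : fresh f F A ≡ s
    fresh≡ = +-cancelˡ-≡ r′ _ _ (suc-injective (begin
      suc (r′ + fresh f F A)  ≡⟨ cong (λ b → toℕ b + (r′ + fresh f F A)) Af ⟨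
      toℕ (A f) + (r′ + fresh f F A)  ≡⟨ size-decompose f F A f∉F distinct ⟨
      size A  ≡⟨ size≡ ⟩
      s + r  ≡⟨ cong (s +_) hits≡ ⟨
      s + suc r′  ≡⟨ +-suc s r′ ⟩
      suc (s + r′)  ≡⟨ cong suc (+-comm s r′) ⟩
      suc (r′ + s) ∎))
  countsAvoiders-∷ {k = k} f F f∉F distinct counts A zero r size≡ hits≡ k≡ | false =
    ⊥-elim (1+n≰n (subst (_≤ k) (trans hits≡ (sym k≡)) (hits≤length A F)))
  countsAvoiders-∷ {k = k} f F f∉F distinct counts A (suc a) r size≡ hits≡ k≡ | false = begin
    admissibleCount (f ∷ F) A
      ≡⟨ admissibleCount-choose f F A f∉F distinct counts a k≡′ (trans size≡ (sym k≡)) ⟩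
    r′ * avoiders (suc a) (pred r′) + fresh f F A * avoiders a r′
      ≡⟨ cong (λ c → r′ * avoiders (suc a) (pred r′) + c * avoiders a r′) fresh≡ ⟩
    r′ * avoiders (suc a) (pred r′) + suc a * avoiders a r′
      ≡⟨ sym (avoiders-sucˡ a r′) ⟩
    avoiders (suc a) r′
      ≡⟨ cong (avoiders (suc a)) hits≡ ⟩
    avoiders (suc a) r ∎
    where
    open ≡-Reasoning
    r′ = hits A F
    k≡′ : k ≡ a + r′
    k≡′ = trans (suc-injective k≡) (cong (a +_) (sym hits≡))
    fresh≡ : fresh f F A ≡ suc a
    fresh≡ = +-cancelˡ-≡ r′ _ _ (begin
      r′ + fresh f F A  ≡⟨ cong (λ b → toℕ b + (r′ + fresh f F A)) Af ⟨
      toℕ (A f) + (r′ + fresh f F A)  ≡⟨ size-decompose f F A f∉F distinct ⟨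
      size A  ≡⟨ size≡ ⟩
      suc a + r  ≡⟨ cong (suc a +_) hits≡ ⟨
      suc a + r′  ≡⟨ +-comm (suc a) r′ ⟩
      r′ + suc a ∎)

  admissibleCount≡avoiders : ∀ {n k} (F : Vec (Fin n) k) → Distinct F → CountsAvoiders F
  admissibleCount≡avoiders []      _ A zero    zero    _ _ _  = refl
  admissibleCount≡avoiders []      _ A zero    (suc r) _ _ ()
  admissibleCount≡avoiders []      _ A (suc s) r       _ _ ()
  admissibleCount≡avoiders (f ∷ F) (f∉F , distinct) =
    countsAvoiders-∷ f F f∉F distinct (admissibleCount≡avoiders F distinct)

  Admissible : ∀ {n k} → Vec (Fin n) k → (Fin n → Bool) → Vec (Fin n) k → Set
  Admissible F A w = Unique (toList w) × All (λ x → A x ≡ true) (toList w) × (∀ i → lookup w i ≢ lookup F i)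

  without-true⇒ : ∀ {n} (A : Fin n → Bool) {x y} → (A without x) y ≡ true → A y ≡ true × x ≢ y
  without-true⇒ A {x} {y} eq with A y | y == x in y=x | eq
  ... | true | false | _ = refl , ≢-sym (==-false⇒≢ y=x)

  ⇒without-true : ∀ {n} (A : Fin n → Bool) {x y} → A y ≡ true × x ≢ y → (A without x) y ≡ true
  ⇒without-true A {x} {y} (Ay , x≢y) rewrite Ay | ≢⇒==-false (≢-sym x≢y) = refl

  admissible-sound : ∀ {n k} (F : Vec (Fin n) k) A w → admissible F A w ≡ true → Admissible F A w
  admissible-sound []      A []      _ = [] , [] , λ ()
  admissible-sound (f ∷ F) A (x ∷ w) ok with A x in Ax | x == f in x=f | ok
  ... | true | false | ok′ with admissible-sound F (A without x) w ok′
  ... | unique , inA , avoids =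
    (All.map (proj₂ ∘ without-true⇒ A) inA ∷ unique) ,
    (Ax ∷ All.map (proj₁ ∘ without-true⇒ A) inA) ,
    λ { zero → ==-false⇒≢ x=f ; (suc i) → avoids i }

  admissible-complete : ∀ {n k} (F : Vec (Fin n) k) A w → Admissible F A w → admissible F A w ≡ true
  admissible-complete []      A []      _ = refl
  admissible-complete (f ∷ F) A (x ∷ w) (x∉w ∷ unique , Ax ∷ inA , avoids)
    rewrite Ax | ≢⇒==-false (avoids zero) =
    admissible-complete F (A without x) w (unique , All.zipWith (⇒without-true A) (inA , x∉w) , avoids ∘ suc)

  ∈ᵇ-tabulate : ∀ {m n} (h : Fin m → Fin n) {x} → (x ∈ᵇ tabulate h) ≡ true → Σ (Fin m) (λ i → x ≡ h i)
  ∈ᵇ-tabulate {suc m} h {x} x∈ with x == h zero in eq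
  ... | true  = zero , ==⇒≡ eq
  ... | false with i , x≡ ← ∈ᵇ-tabulate (h ∘ suc) x∈ = suc i , x≡

  distinct-tabulate : ∀ {m n} (h : Fin m → Fin n) → Injective _≡_ _≡_ h → Distinct (tabulate h)
  distinct-tabulate {zero}  h injective = tt
  distinct-tabulate {suc m} h injective = head∉tail , distinct-tabulate (h ∘ suc) (Fin-suc-injective ∘ injective)
    where
    head∉tail : (h zero ∈ᵇ tabulate (h ∘ suc)) ≡ false
    head∉tail with h zero ∈ᵇ tabulate (h ∘ suc) in eq
    ... | false = refl
    ... | true with i , h0≡ ← ∈ᵇ-tabulate (h ∘ suc) eq with () ← injective h0≡

  hits-all : ∀ {n k} (F : Vec (Fin n) k) → hits (λ _ → true) F ≡ k
  hits-all []      = refl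
  hits-all (f ∷ F) = cong suc (hits-all F)

  D≡avoiders : ∀ n → D n ≡ avoiders 0 n
  D≡avoiders n = begin
    D n
      ≡⟨ length-filter≡count isDerangement? (admissible (allFin n) all) derangement⇒admissible admissible⇒derangement (allVecs n n) ⟩
    admissibleCount (allFin n) all
      ≡⟨ admissibleCount≡avoiders (allFin n) (distinct-tabulate id id) all 0 n (size-all n) (hits-all (allFin n)) refl ⟩
    avoiders 0 n ∎
    where
    open ≡-Reasoning
    all : Fin n → Bool
    all _ = true
    derangement⇒admissible : ∀ v → IsDerangement v → admissible (allFin n) all v ≡ true
    derangement⇒admissible v (unique , noFix) = admissible-complete (allFin n) all v
      (unique , All.universal (λ _ → refl) (toList v) , λ i v≡ → noFix i (trans v≡ (lookup-allFin i)))
    admissible⇒derangement : ∀ v → admissible (allFin n) all v ≡ true → IsDerangement v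
    admissible⇒derangement v ok with unique , _ , avoids ← admissible-sound (allFin n) all v ok =
      unique , λ i v≡ → avoids i (trans v≡ (sym (lookup-allFin i)))

  derangement-recurrence : ∀ r → D (suc (suc r)) ≡ suc r * (D (suc r) + D r)
  derangement-recurrence r rewrite D≡avoiders (suc (suc r)) | D≡avoiders (suc r) | D≡avoiders r =
    avoiders-derangement-rec r

module SeriesBounds where

  open import Data.Nat.Base as ℕ using (ℕ; zero; suc; _!)
  import Data.Nat.Properties as ℕ
  open import Data.Integer.Base as ℤ using (ℤ; +_)
  import Data.Integer.Properties as ℤ
  open import Data.Rational.Base using (ℚ; 0ℚ; 1ℚ; _/_; _+_; _*_; -_; _-_; _≤_; _<_; toℚᵘ; nonNegative; positive)
  open import Data.Unit using (tt)
  open import Relation.Nullary.Decidable using (toWitness)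
  open import Data.Rational.Properties
  import Data.Rational.Unnormalised.Base as U
  import Data.Rational.Unnormalised.Properties as U
  open import Data.Rational.Solver using (module +-*-Solver)
  open +-*-Solver using (solve; _:+_; _:*_; _:-_; :-_; _:=_; con)
  open import Data.Product using (_×_; _,_; proj₁; proj₂)
  open import Data.Sum using (_⊎_; inj₁; inj₂)
  open import Data.Empty using (⊥-elim)
  open import Function using (_∘_)
  open import Relation.Binary.Definitions using (tri<; tri≈; tri>)
  open import Relation.Nullary using (¬_)
  open import Relation.Binary.PropositionalEquality
  open DerangementRecurrence using (derangement-recurrence)

  toℚᵘ-/ : ∀ i d → toℚᵘ (i / suc d) U.≃ U.mkℚᵘ i d
  toℚᵘ-/ i d = toℚᵘ-fromℚᵘ (U.mkℚᵘ i d)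

  /-cross-≡ : ∀ i j d e → i ℤ.* + suc e ≡ j ℤ.* + suc d → i / suc d ≡ j / suc e
  /-cross-≡ i j d e eq = toℚᵘ-injective (U.≃-trans (toℚᵘ-/ i d) (U.≃-trans (U.*≡* eq) (U.≃-sym (toℚᵘ-/ j e))))

  /-cross-≤ : ∀ i j d e → i ℤ.* + suc e ℤ.≤ j ℤ.* + suc d → i / suc d ≤ j / suc e
  /-cross-≤ i j d e le =
    toℚᵘ-cancel-≤ (U.≤-respʳ-≃ (U.≃-sym (toℚᵘ-/ j e)) (U.≤-respˡ-≃ (U.≃-sym (toℚᵘ-/ i d)) (U.*≤* le)))

  /-cross-< : ∀ i j d e → i ℤ.* + suc e ℤ.< j ℤ.* + suc d → i / suc d < j / suc e
  /-cross-< i j d e lt =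
    toℚᵘ-cancel-< (U.<-respʳ-≃ (U.≃-sym (toℚᵘ-/ j e)) (U.<-respˡ-≃ (U.≃-sym (toℚᵘ-/ i d)) (U.*<* lt)))

  /-* : ∀ i j d e → (i / suc d) * (j / suc e) ≡ (i ℤ.* j) / suc (e ℕ.+ d ℕ.* suc e)
  /-* i j d e = toℚᵘ-injective (U.≃-trans (toℚᵘ-homo-* (i / suc d) (j / suc e))
    (U.≃-trans (U.*-cong (toℚᵘ-/ i d) (toℚᵘ-/ j e)) (U.≃-sym (toℚᵘ-/ _ _))))

  /1-+ : ∀ i j → (i ℤ.+ j) / 1 ≡ i / 1 + j / 1
  /1-+ i j = toℚᵘ-injective (U.≃-trans (toℚᵘ-/ (i ℤ.+ j) 0)
    (U.≃-trans (U.*≡* (cong (ℤ._* + 1) (sym (cong₂ ℤ._+_ (ℤ.*-identityʳ i) (ℤ.*-identityʳ j)))))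
      (U.≃-sym (U.≃-trans (toℚᵘ-homo-+ (i / 1) (j / 1)) (U.+-cong (toℚᵘ-/ i 0) (toℚᵘ-/ j 0))))))

  /1-* : ∀ i j → (i ℤ.* j) / 1 ≡ (i / 1) * (j / 1)
  /1-* i j = sym (/-* i j 0 0)

  /1-mono-≤ : ∀ {i j} → i ℤ.≤ j → i / 1 ≤ j / 1
  /1-mono-≤ {i} {j} le = /-cross-≤ i j 0 0 (subst₂ ℤ._≤_ (sym (ℤ.*-identityʳ i)) (sym (ℤ.*-identityʳ j)) le)

  /1-mono-< : ∀ {i j} → i ℤ.< j → i / 1 < j / 1
  /1-mono-< {i} {j} lt = /-cross-< i j 0 0 (subst₂ ℤ._<_ (sym (ℤ.*-identityʳ i)) (sym (ℤ.*-identityʳ j)) lt)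

  fromℕ : ℕ → ℚ
  fromℕ k = + k / 1

  fromℕ-+ : ∀ a b → fromℕ (a ℕ.+ b) ≡ fromℕ a + fromℕ b
  fromℕ-+ a b = trans (cong (_/ 1) (ℤ.pos-+ a b)) (/1-+ (+ a) (+ b))

  fromℕ-* : ∀ a b → fromℕ (a ℕ.* b) ≡ fromℕ a * fromℕ b
  fromℕ-* a b = trans (cong (_/ 1) (ℤ.pos-* a b)) (/1-* (+ a) (+ b))

  fromℕ-mono-≤ : ∀ {a b} → a ℕ.≤ b → fromℕ a ≤ fromℕ b
  fromℕ-mono-≤ a≤b = /1-mono-≤ (ℤ.+≤+ a≤b)

  fromℕ-nonNeg : ∀ k → 0ℚ ≤ fromℕ k
  fromℕ-nonNeg k = fromℕ-mono-≤ {0} {k} ℕ.z≤n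

  fromℕ-pos : ∀ k → 0ℚ < fromℕ (suc k)
  fromℕ-pos k = /1-mono-< {+ 0} {+ suc k} (ℤ.+<+ (ℕ.s≤s ℕ.z≤n))

  recip : ℕ → ℚ
  recip = div (+ 1)

  div-*-fromℕ : ∀ y d → div y (suc d) * fromℕ (suc d) ≡ y / 1
  div-*-fromℕ y d = trans (/-* y (+ suc d) d 0) (/-cross-≡ (y ℤ.* + suc d) y (0 ℕ.+ d ℕ.* 1) 0
    (trans (ℤ.*-identityʳ _) (cong (λ z → y ℤ.* + suc z) (sym (ℕ.*-identityʳ d)))))

  recip-inverse : ∀ d → 1 ℕ.≤ d → recip d * fromℕ d ≡ 1ℚ
  recip-inverse (suc d) _ = div-*-fromℕ (+ 1) d

  recip-pos : ∀ d → 1 ℕ.≤ d → 0ℚ < recip d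
  recip-pos (suc d) _ = /-cross-< (+ 0) (+ 1) 0 d (ℤ.+<+ (ℕ.s≤s ℕ.z≤n))

  recip-antitone : ∀ {a b} → suc a ℕ.≤ suc b → recip (suc b) ≤ recip (suc a)
  recip-antitone {a} {b} a≤b =
    /-cross-≤ (+ 1) (+ 1) b a (subst₂ ℤ._≤_ (sym (ℤ.*-identityˡ (+ suc a))) (sym (ℤ.*-identityˡ (+ suc b))) (ℤ.+≤+ a≤b))

  *-cancelʳ-inverse : ∀ {p q c r : ℚ} → c * r ≡ 1ℚ → p * c ≡ q * c → p ≡ q
  *-cancelʳ-inverse {p} {q} {c} {r} c*r≡1 eq = begin
    p              ≡⟨ sym (*-identityʳ p) ⟩
    p * 1ℚ         ≡⟨ cong (p *_) (sym c*r≡1) ⟩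
    p * (c * r)    ≡⟨ sym (*-assoc p c r) ⟩
    (p * c) * r    ≡⟨ cong (_* r) eq ⟩
    (q * c) * r    ≡⟨ *-assoc q c r ⟩
    q * (c * r)    ≡⟨ cong (q *_) c*r≡1 ⟩
    q * 1ℚ         ≡⟨ *-identityʳ q ⟩
    q ∎
    where open ≡-Reasoning

  div-unique : ∀ y d x → 1 ℕ.≤ d → x * fromℕ d ≡ y / 1 → div y d ≡ x
  div-unique y (suc d) x _ eq =
    *-cancelʳ-inverse (trans (*-comm (fromℕ (suc d)) (recip (suc d))) (recip-inverse (suc d) (ℕ.s≤s ℕ.z≤n))) (trans (div-*-fromℕ y d) (sym eq))

  ≤-by-gap : ∀ {p q} d → q ≡ p + d → 0ℚ ≤ d → p ≤ q
  ≤-by-gap {p} {q} d q≡ 0≤d = subst₂ _≤_ (+-identityʳ p) (sym q≡) (+-monoʳ-≤ p 0≤d)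

  <-by-gap : ∀ {p q} d → q ≡ p + d → 0ℚ < d → p < q
  <-by-gap {p} {q} d q≡ 0<d = subst₂ _<_ (+-identityʳ p) (sym q≡) (+-monoʳ-< p 0<d)

  ≤⇒0≤- : ∀ {p q} → p ≤ q → 0ℚ ≤ q - p
  ≤⇒0≤- {p} {q} p≤q = subst (_≤ q - p) (+-inverseʳ p) (+-monoˡ-≤ (- p) p≤q)

  *-nonNeg : ∀ {a b} → 0ℚ ≤ a → 0ℚ ≤ b → 0ℚ ≤ a * b
  *-nonNeg {a} {b} 0≤a 0≤b = subst (_≤ a * b) (*-zeroʳ a) (*-monoˡ-≤-nonNeg a {{nonNegative 0≤a}} 0≤b)

  *-pos : ∀ {a b} → 0ℚ < a → 0ℚ < b → 0ℚ < a * b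
  *-pos {a} {b} 0<a 0<b = subst (_< a * b) (*-zeroˡ b) (*-monoˡ-<-pos b {{positive 0<b}} 0<a)

  *-monoˡ-≤-of-nonNeg : ∀ {a x y} → 0ℚ ≤ a → x ≤ y → a * x ≤ a * y
  *-monoˡ-≤-of-nonNeg {a} 0≤a = *-monoˡ-≤-nonNeg a {{nonNegative 0≤a}}

  *-monoʳ-≤-of-nonNeg : ∀ {a x y} → 0ℚ ≤ a → x ≤ y → x * a ≤ y * a
  *-monoʳ-≤-of-nonNeg {a} 0≤a = *-monoʳ-≤-nonNeg a {{nonNegative 0≤a}}

  invFact : ℕ → ℚ
  invFact k = recip (k !)

  invFact-inverse : ∀ k → invFact k * fromℕ (k !) ≡ 1ℚ
  invFact-inverse k = recip-inverse (k !) (ℕ.1≤n! k)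

  invFact-pos : ∀ k → 0ℚ < invFact k
  invFact-pos k = recip-pos (k !) (ℕ.1≤n! k)

  invFact-nonNeg : ∀ k → 0ℚ ≤ invFact k
  invFact-nonNeg k = <⇒≤ (invFact-pos k)

  fromℕ-*-invFact-suc : ∀ k → fromℕ (suc k) * invFact (suc k) ≡ invFact k
  fromℕ-*-invFact-suc k = *-cancelʳ-inverse (trans (*-comm (fromℕ (k !)) (invFact k)) (invFact-inverse k)) (begin
    fromℕ (suc k) * invFact (suc k) * fromℕ (k !)    ≡⟨ solve 3 (λ a b c → a :* b :* c := b :* (a :* c)) refl (fromℕ (suc k)) (invFact (suc k)) (fromℕ (k !)) ⟩
    invFact (suc k) * (fromℕ (suc k) * fromℕ (k !))  ≡⟨ cong (invFact (suc k) *_) (fromℕ-* (suc k) (k !)) ⟨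
    invFact (suc k) * fromℕ (suc k !)                ≡⟨ invFact-inverse (suc k) ⟩
    1ℚ                                               ≡⟨ invFact-inverse k ⟨
    invFact k * fromℕ (k !)                          ∎)
    where open ≡-Reasoning

  invFact-antitone : ∀ k → invFact (suc k) ≤ invFact k
  invFact-antitone k = ≤-by-gap (fromℕ k * invFact (suc k)) (begin
    invFact k                                    ≡⟨ fromℕ-*-invFact-suc k ⟨
    fromℕ (1 ℕ.+ k) * invFact (suc k)            ≡⟨ cong (_* invFact (suc k)) (fromℕ-+ 1 k) ⟩
    (1ℚ + fromℕ k) * invFact (suc k)             ≡⟨ solve 2 (λ a b → (con 1ℚ :+ a) :* b := b :+ a :* b) refl (fromℕ k) (invFact (suc k)) ⟩
    invFact (suc k) + fromℕ k * invFact (suc k)  ∎)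
    (*-nonNeg (fromℕ-nonNeg k) (invFact-nonNeg (suc k)))
    where open ≡-Reasoning

  S-mono : ∀ K L → S K ≤ S (K ℕ.+ L)
  S-mono K zero    = ≤-reflexive (cong S (sym (ℕ.+-identityʳ K)))
  S-mono K (suc L) = subst (λ j → S K ≤ S j) (sym (ℕ.+-suc K L))
    (≤-trans (S-mono K L) (≤-by-gap (invFact (suc (K ℕ.+ L))) refl (invFact-nonNeg (suc (K ℕ.+ L)))))

  1≤S : ∀ K → 1ℚ ≤ S K
  1≤S = S-mono 0

  S-nonNeg : ∀ K → 0ℚ ≤ S K
  S-nonNeg K = ≤-trans (fromℕ-nonNeg 1) (1≤S K)

  scaledS : ℕ → ℕ
  scaledS zero    = 1
  scaledS (suc k) = suc k ℕ.* scaledS k ℕ.+ 1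

  S*fromℕ! : ∀ K → S K * fromℕ (K !) ≡ fromℕ (scaledS K)
  S*fromℕ! zero    = refl
  S*fromℕ! (suc K) = begin
    (S K + e) * fromℕ (suc K ℕ.* K !)              ≡⟨ cong ((S K + e) *_) (fromℕ-* (suc K) (K !)) ⟩
    (S K + e) * (fromℕ (suc K) * fromℕ (K !))      ≡⟨ solve 4 (λ s e a b → (s :+ e) :* (a :* b) := a :* (s :* b) :+ e :* (a :* b)) refl (S K) e (fromℕ (suc K)) (fromℕ (K !)) ⟩
    fromℕ (suc K) * (S K * fromℕ (K !)) + e * (fromℕ (suc K) * fromℕ (K !))
      ≡⟨ cong₂ (λ x y → fromℕ (suc K) * x + e * y) (S*fromℕ! K) (sym (fromℕ-* (suc K) (K !))) ⟩
    fromℕ (suc K) * fromℕ (scaledS K) + e * fromℕ (suc K !)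
      ≡⟨ cong₂ _+_ (sym (fromℕ-* (suc K) (scaledS K))) (invFact-inverse (suc K)) ⟩
    fromℕ (suc K ℕ.* scaledS K) + 1ℚ               ≡⟨ fromℕ-+ (suc K ℕ.* scaledS K) 1 ⟨
    fromℕ (scaledS (suc K))                         ∎
    where
    open ≡-Reasoning
    e = invFact (suc K)

  -- The classical upper bound e < S (M + 1) + 1 / ((M + 1) (M + 1)!).
  eUpper : ℕ → ℚ
  eUpper M = S (suc M) + invFact (suc M) * recip (suc M)

  eUpper-suc : ∀ M → eUpper (suc M) ≤ eUpper M
  eUpper-suc M = ≤-by-gap (e₂ * (r₁ - r₂)) (begin
    s + e₁ * r₁                              ≡⟨ cong (λ z → s + z * r₁) (fromℕ-*-invFact-suc (suc M)) ⟨
    s + (fromℕ (1 ℕ.+ suc M) * e₂) * r₁      ≡⟨ cong (λ z → s + (z * e₂) * r₁) (fromℕ-+ 1 (suc M)) ⟩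
    s + ((1ℚ + a) * e₂) * r₁                 ≡⟨ solve 4 (λ s a e₂ r₁ → s :+ ((con 1ℚ :+ a) :* e₂) :* r₁ := s :+ e₂ :* r₁ :+ e₂ :* (a :* r₁)) refl s a e₂ r₁ ⟩
    s + e₂ * r₁ + e₂ * (a * r₁)              ≡⟨ cong (λ z → s + e₂ * r₁ + e₂ * z) (trans (*-comm a r₁) (recip-inverse (suc M) (ℕ.s≤s ℕ.z≤n))) ⟩
    s + e₂ * r₁ + e₂ * 1ℚ                    ≡⟨ solve 4 (λ s e₂ r₁ r₂ → s :+ e₂ :* r₁ :+ e₂ :* con 1ℚ := (s :+ e₂ :+ e₂ :* r₂) :+ e₂ :* (r₁ :- r₂)) refl s e₂ r₁ r₂ ⟩
    eUpper (suc M) + e₂ * (r₁ - r₂)          ∎)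
    (*-nonNeg (invFact-nonNeg (suc (suc M))) (≤⇒0≤- (recip-antitone (ℕ.n≤1+n (suc M)))))
    where
    open ≡-Reasoning
    s = S (suc M)
    a = fromℕ (suc M)
    e₁ = invFact (suc M)
    e₂ = invFact (suc (suc M))
    r₁ = recip (suc M)
    r₂ = recip (suc (suc M))

  eUpper-antitone : ∀ M L → eUpper (M ℕ.+ L) ≤ eUpper M
  eUpper-antitone M zero    = ≤-reflexive (cong eUpper (ℕ.+-identityʳ M))
  eUpper-antitone M (suc L) = subst (λ j → eUpper j ≤ eUpper M) (sym (ℕ.+-suc M L))
    (≤-trans (eUpper-suc (M ℕ.+ L)) (eUpper-antitone M L))

  +-suc-comm : ∀ m K → m ℕ.+ suc K ≡ suc (K ℕ.+ m)
  +-suc-comm m K = trans (ℕ.+-suc m K) (cong suc (ℕ.+-comm m K))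

  S≤eUpper : ∀ K M → S K ≤ eUpper M
  S≤eUpper K M = begin
    S K                    ≤⟨ S-mono K (suc M) ⟩
    S (K ℕ.+ suc M)        ≡⟨ cong S (+-suc-comm K M) ⟩
    S (suc (M ℕ.+ K))      ≤⟨ ≤-by-gap (invFact (suc (M ℕ.+ K)) * recip (suc (M ℕ.+ K))) refl
                                (*-nonNeg (invFact-nonNeg (suc (M ℕ.+ K))) (<⇒≤ (recip-pos (suc (M ℕ.+ K)) (ℕ.s≤s ℕ.z≤n)))) ⟩
    eUpper (M ℕ.+ K)       ≤⟨ eUpper-antitone M K ⟩
    eUpper M               ∎
    where open ≤-Reasoning

  sign : ℕ → ℚ
  sign zero    = 1ℚ
  sign (suc k) = - sign k

  sign-sq : ∀ k → sign k * sign k ≡ 1ℚ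
  sign-sq zero    = refl
  sign-sq (suc k) = trans (solve 1 (λ a → (:- a) :* (:- a) := a :* a) refl (sign k)) (sign-sq k)

  sign-±1 : ∀ k → (sign k ≡ 1ℚ) ⊎ (sign k ≡ - 1ℚ)
  sign-±1 zero    = inj₁ refl
  sign-±1 (suc k) with sign-±1 k
  ... | inj₁ eq = inj₂ (cong -_ eq)
  ... | inj₂ eq = inj₁ (cong -_ eq)

  fromℕ-D-suc : ∀ j → fromℕ (D (suc j)) ≡ fromℕ (suc j) * fromℕ (D j) + sign (suc j)
  fromℕ-D-suc zero    = refl
  fromℕ-D-suc (suc j) = begin
    fromℕ (D (suc (suc j)))                 ≡⟨ cong fromℕ (derangement-recurrence j) ⟩
    fromℕ (suc j ℕ.* (D (suc j) ℕ.+ D j))   ≡⟨ trans (fromℕ-* (suc j) (D (suc j) ℕ.+ D j)) (cong (a *_) (fromℕ-+ (D (suc j)) (D j))) ⟩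
    a * (y + x)                             ≡⟨ cong (λ z → a * (z + x)) (fromℕ-D-suc j) ⟩
    a * ((a * x + σ) + x)                   ≡⟨ solve 3 (λ a x σ → a :* ((a :* x :+ σ) :+ x) := (con 1ℚ :+ a) :* (a :* x :+ σ) :+ (:- σ)) refl a x σ ⟩
    (1ℚ + a) * (a * x + σ) + - σ            ≡⟨ cong₂ (λ b z → b * z + - σ) (sym (fromℕ-+ 1 (suc j))) (sym (fromℕ-D-suc j)) ⟩
    fromℕ (suc (suc j)) * y + - σ           ∎
    where
    open ≡-Reasoning
    a = fromℕ (suc j)
    x = fromℕ (D j)
    y = fromℕ (D (suc j))
    σ = sign (suc j)

  -- T j is the j-th partial sum of Σ (-1)^i / i! = 1 / e.
  T : ℕ → ℚ
  T j = fromℕ (D j) * invFact j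

  T-suc : ∀ j → T (suc j) ≡ T j + sign (suc j) * invFact (suc j)
  T-suc j = begin
    fromℕ (D (suc j)) * invFact (suc j)          ≡⟨ cong (_* invFact (suc j)) (fromℕ-D-suc j) ⟩
    (a * x + σ) * invFact (suc j)                ≡⟨ solve 4 (λ a x σ e → (a :* x :+ σ) :* e := x :* (a :* e) :+ σ :* e) refl a x σ (invFact (suc j)) ⟩
    x * (a * invFact (suc j)) + σ * invFact (suc j)  ≡⟨ cong (λ z → x * z + σ * invFact (suc j)) (fromℕ-*-invFact-suc j) ⟩
    x * invFact j + σ * invFact (suc j)          ∎
    where
    open ≡-Reasoning
    a = fromℕ (suc j)
    x = fromℕ (D j)
    σ = sign (suc j)

  SignedBracket : ℕ → ℕ → Set
  SignedBracket m k = (0ℚ ≤ sign (suc m) * (T k - T m)) × (sign (suc m) * (T k - T m) ≤ invFact (suc m))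

  T-bracket : ∀ m L → SignedBracket m (m ℕ.+ L)
  T-bracket m zero = subst (SignedBracket m) (sym (ℕ.+-identityʳ m))
    (subst (λ v → (0ℚ ≤ v) × (v ≤ invFact (suc m))) (sym σ[t-t]≡0) (≤-refl , invFact-nonNeg (suc m)))
    where
    σ[t-t]≡0 : sign (suc m) * (T m - T m) ≡ 0ℚ
    σ[t-t]≡0 = solve 2 (λ σ t → σ :* (t :- t) := con 0ℚ) refl (sign (suc m)) (T m)
  T-bracket m (suc L) = subst (SignedBracket m) (sym (ℕ.+-suc m L))
    (subst (0ℚ ≤_) (sym V≡) (≤⇒0≤- (≤-trans (proj₂ ih) (invFact-antitone (suc m)))) ,
     subst (_≤ e) (sym V≡) (≤-by-gap X (solve 2 (λ e X → e := (e :- X) :+ X) refl e X) (proj₁ ih)))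
    where
    σ = sign (suc m)
    A = T (suc m ℕ.+ L)
    t = T m
    e = invFact (suc m)
    X = sign (suc (suc m)) * (A - T (suc m))
    ih = T-bracket (suc m) L
    V≡ : σ * (A - t) ≡ e - X
    V≡ = begin
      σ * (A - t)                              ≡⟨ solve 4 (λ σ A t e → σ :* (A :- t) := σ :* σ :* e :- (:- σ) :* (A :- (t :+ σ :* e))) refl σ A t e ⟩
      σ * σ * e - (- σ) * (A - (t + σ * e))    ≡⟨ cong₂ (λ p q → p * e - (- σ) * (A - q)) (sign-sq (suc m)) (sym (T-suc m)) ⟩
      1ℚ * e - X                               ≡⟨ cong (_- X) (*-identityˡ e) ⟩
      e - X                                    ∎
      where open ≡-Reasoning

  ±1-bracket : ∀ {σ d e} → (σ ≡ 1ℚ) ⊎ (σ ≡ - 1ℚ) → 0ℚ ≤ σ * d → σ * d ≤ e → (- e ≤ d) × (d ≤ e)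
  ±1-bracket {σ} {d} {e} (inj₁ refl) lo hi =
    ≤-trans (neg-antimono-≤ (≤-trans lo′ hi′)) lo′ , hi′
    where
    lo′ = subst (0ℚ ≤_) (*-identityˡ d) lo
    hi′ = subst (_≤ e) (*-identityˡ d) hi
  ±1-bracket {σ} {d} {e} (inj₂ refl) lo hi =
    subst (- e ≤_) neg-neg-d (neg-antimono-≤ hi′) ,
    ≤-trans (subst (_≤ 0ℚ) neg-neg-d (neg-antimono-≤ lo′)) (≤-trans lo′ hi′)
    where
    neg-neg-d : - - d ≡ d
    neg-neg-d = solve 1 (λ d → :- (:- d) := d) refl d
    -1*d≡-d : - 1ℚ * d ≡ - d
    -1*d≡-d = solve 1 (λ d → (:- con 1ℚ) :* d := :- d) refl d
    lo′ = subst (0ℚ ≤_) -1*d≡-d lo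
    hi′ = subst (_≤ e) -1*d≡-d hi

  T-near : ∀ m L → (T m - invFact (suc m) ≤ T (m ℕ.+ L)) × (T (m ℕ.+ L) ≤ T m + invFact (suc m))
  T-near m L = lower , upper
    where
    A = T (m ℕ.+ L)
    t = T m
    e = invFact (suc m)
    bounds : (- e ≤ A - t) × (A - t ≤ e)
    bounds = ±1-bracket (sign-±1 (suc m)) (proj₁ (T-bracket m L)) (proj₂ (T-bracket m L))
    [A-t]+t≡A : (A - t) + t ≡ A
    [A-t]+t≡A = solve 2 (λ A t → (A :- t) :+ t := A) refl A t
    lower : t - e ≤ A
    lower = subst₂ _≤_ (+-comm (- e) t) [A-t]+t≡A (+-monoˡ-≤ t (proj₁ bounds))
    upper : A ≤ t + e
    upper = subst₂ _≤_ [A-t]+t≡A (+-comm e t) (+-monoˡ-≤ t (proj₂ bounds))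

  T-nonNeg : ∀ j → 0ℚ ≤ T j
  T-nonNeg zero    = fromℕ-nonNeg 1
  T-nonNeg (suc j) = subst (0ℚ ≤_) (solve 1 (λ A → con 1ℚ :* (A :- con 0ℚ) := A) refl (T (suc j))) (proj₁ (T-bracket 1 j))

  T≤1 : ∀ j → T j ≤ 1ℚ
  T≤1 zero    = ≤-refl
  T≤1 (suc j) = ≤-trans (proj₂ (T-near 1 j)) (toWitness {a? = T 1 + invFact 2 ≤? 1ℚ} tt)

  cauchy : (ℕ → ℚ) → (ℕ → ℚ) → ℕ → ℚ
  cauchy f g zero    = f 0 * g 0
  cauchy f g (suc n) = f 0 * g (suc n) + cauchy (f ∘ suc) g n

  cauchy-cong : ∀ n {f f′ g g′ : ℕ → ℚ} → (∀ i → f i ≡ f′ i) → (∀ j → g j ≡ g′ j) → cauchy f g n ≡ cauchy f′ g′ n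
  cauchy-cong zero    f≗ g≗ = cong₂ _*_ (f≗ 0) (g≗ 0)
  cauchy-cong (suc n) f≗ g≗ = cong₂ _+_ (cong₂ _*_ (f≗ 0) (g≗ (suc n))) (cauchy-cong n (f≗ ∘ suc) g≗)

  cauchy-+ˡ : ∀ n (f h g : ℕ → ℚ) → cauchy (λ i → f i + h i) g n ≡ cauchy f g n + cauchy h g n
  cauchy-+ˡ zero    f h g = *-distribʳ-+ (g 0) (f 0) (h 0)
  cauchy-+ˡ (suc n) f h g rewrite cauchy-+ˡ n (f ∘ suc) (h ∘ suc) g =
    solve 5 (λ a b c p q → (a :+ b) :* c :+ (p :+ q) := (a :* c :+ p) :+ (b :* c :+ q)) refl
      (f 0) (h 0) (g (suc n)) (cauchy (f ∘ suc) g n) (cauchy (h ∘ suc) g n)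

  cauchy-negˡ : ∀ n (f g : ℕ → ℚ) → cauchy (λ i → - f i) g n ≡ - cauchy f g n
  cauchy-negˡ zero    f g = sym (neg-distribˡ-* (f 0) (g 0))
  cauchy-negˡ (suc n) f g rewrite cauchy-negˡ n (f ∘ suc) g =
    solve 3 (λ a b c → (:- a) :* b :+ (:- c) := :- (a :* b :+ c)) refl (f 0) (g (suc n)) (cauchy (f ∘ suc) g n)

  cauchy-suc : ∀ n (f g : ℕ → ℚ) → cauchy f g (suc n) ≡ cauchy f (g ∘ suc) n + f (suc n) * g 0
  cauchy-suc zero    f g = refl
  cauchy-suc (suc n) f g rewrite cauchy-suc n (f ∘ suc) g =
    sym (+-assoc (f 0 * g (suc (suc n))) (cauchy (f ∘ suc) (g ∘ suc) n) (f (suc (suc n)) * g 0))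

  cauchy-comm : ∀ n (f g : ℕ → ℚ) → cauchy f g n ≡ cauchy g f n
  cauchy-comm zero    f g = *-comm (f 0) (g 0)
  cauchy-comm (suc n) f g rewrite cauchy-comm n (f ∘ suc) g | cauchy-suc n g f =
    trans (+-comm (f 0 * g (suc n)) (cauchy g (f ∘ suc) n)) (cong (λ z → cauchy g (f ∘ suc) n + z) (*-comm (f 0) (g (suc n))))

  cauchy-weighted : ∀ m (f g : ℕ → ℚ) →
    cauchy (λ i → fromℕ i * f i) g m + cauchy f (λ j → fromℕ j * g j) m ≡ fromℕ m * cauchy f g m
  cauchy-weighted zero    f g =
    solve 2 (λ a b → con 0ℚ :* a :* b :+ a :* (con 0ℚ :* b) := con 0ℚ :* (a :* b)) refl (f 0) (g 0)
  cauchy-weighted (suc m) f g = begin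
    0ℚ * a * b + cauchy (λ i → fromℕ (suc i) * f (suc i)) g m + (a * (fromℕ (suc m) * b) + W)
       ≡⟨ cong₂ (λ z y → 0ℚ * a * b + z + (a * (y * b) + W)) shift (fromℕ-+ 1 m) ⟩
    0ℚ * a * b + (P + Q) + (a * ((1ℚ + k) * b) + W)
       ≡⟨ solve 6 (λ a b k P Q W → con 0ℚ :* a :* b :+ (P :+ Q) :+ (a :* ((con 1ℚ :+ k) :* b) :+ W)
                                 := (con 0ℚ :* a :* b :+ P :+ a :* ((con 1ℚ :+ k) :* b)) :+ (Q :+ W)) refl a b k P Q W ⟩
    (0ℚ * a * b + P + a * ((1ℚ + k) * b)) + (Q + W)
       ≡⟨ cong (λ z → (0ℚ * a * b + P + a * ((1ℚ + k) * b)) + z) (cauchy-weighted m (f ∘ suc) g) ⟩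
    (0ℚ * a * b + P + a * ((1ℚ + k) * b)) + k * P
       ≡⟨ solve 4 (λ a b k P → (con 0ℚ :* a :* b :+ P :+ a :* ((con 1ℚ :+ k) :* b)) :+ k :* P
                             := (con 1ℚ :+ k) :* (a :* b :+ P)) refl a b k P ⟩
    (1ℚ + k) * (a * b + P)
       ≡⟨ cong (_* (a * b + P)) (sym (fromℕ-+ 1 m)) ⟩
    fromℕ (suc m) * (a * b + P) ∎
    where
    open ≡-Reasoning
    a = f 0
    b = g (suc m)
    k = fromℕ m
    P = cauchy (f ∘ suc) g m
    Q = cauchy (λ i → fromℕ i * f (suc i)) g m
    W = cauchy (f ∘ suc) (λ j → fromℕ j * g j) m
    shift : cauchy (λ i → fromℕ (suc i) * f (suc i)) g m ≡ P + Q
    shift = trans (cauchy-cong m (λ i → trans (cong (_* f (suc i)) (fromℕ-+ 1 i))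
                                               (solve 2 (λ k x → (con 1ℚ :+ k) :* x := x :+ k :* x) refl (fromℕ i) (f (suc i))))
                                 (λ _ → refl))
                  (cauchy-+ˡ m (f ∘ suc) (λ i → fromℕ i * f (suc i)) g)

  signedInvFact : ℕ → ℚ
  signedInvFact j = sign j * invFact j

  -- Σ_{i + j = m + 1} (-1)^i / (i! j!) = (1 - 1)^(m + 1) / (m + 1)!.  By cauchy-weighted,
  -- (m + 1) times it is - (the sum for m) + (the sum for m), since i / i! = 1 / (i - 1)!.
  cauchy-signedInvFact-invFact : ∀ m → cauchy signedInvFact invFact (suc m) ≡ 0ℚ
  cauchy-signedInvFact-invFact m = *-cancelʳ-inverse (trans (*-comm (fromℕ (suc m)) (recip (suc m))) (recip-inverse (suc m) (ℕ.s≤s ℕ.z≤n))) (begin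
    β (suc m) * fromℕ (suc m)                   ≡⟨ *-comm (β (suc m)) (fromℕ (suc m)) ⟩
    fromℕ (suc m) * β (suc m)                   ≡⟨ cauchy-weighted (suc m) signedInvFact invFact ⟨
    cauchy (λ i → fromℕ i * signedInvFact i) invFact (suc m) + cauchy signedInvFact (λ j → fromℕ j * invFact j) (suc m)
                                                ≡⟨ cong₂ _+_ left right ⟩
    - β m + β m                                 ≡⟨ +-inverseˡ (β m) ⟩
    0ℚ                                          ≡⟨ *-zeroˡ (fromℕ (suc m)) ⟨
    0ℚ * fromℕ (suc m)                          ∎)
    where
    open ≡-Reasoning
    β = cauchy signedInvFact invFact
    left : cauchy (λ i → fromℕ i * signedInvFact i) invFact (suc m) ≡ - β m
    left = begin
      0ℚ * signedInvFact 0 * invFact (suc m) + cauchy (λ i → fromℕ (suc i) * signedInvFact (suc i)) invFact m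
        ≡⟨ cong₂ _+_ (solve 2 (λ s e → con 0ℚ :* s :* e := con 0ℚ) refl (signedInvFact 0) (invFact (suc m)))
                     (cauchy-cong m (λ i → trans (solve 3 (λ a s e → a :* ((:- s) :* e) := :- (s :* (a :* e))) refl
                                                          (fromℕ (suc i)) (sign i) (invFact (suc i)))
                                                 (cong (λ z → - (sign i * z)) (fromℕ-*-invFact-suc i)))
                                    (λ _ → refl)) ⟩
      0ℚ + cauchy (λ i → - signedInvFact i) invFact m  ≡⟨ +-identityˡ _ ⟩
      cauchy (λ i → - signedInvFact i) invFact m       ≡⟨ cauchy-negˡ m signedInvFact invFact ⟩
      - β m                                            ∎
    right : cauchy signedInvFact (λ j → fromℕ j * invFact j) (suc m) ≡ β m
    right = begin
      cauchy signedInvFact (λ j → fromℕ j * invFact j) (suc m)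
        ≡⟨ cauchy-suc m signedInvFact (λ j → fromℕ j * invFact j) ⟩
      cauchy signedInvFact (λ j → fromℕ (suc j) * invFact (suc j)) m + signedInvFact (suc m) * (0ℚ * invFact 0)
        ≡⟨ cong₂ _+_ (cauchy-cong m (λ _ → refl) fromℕ-*-invFact-suc) (solve 1 (λ s → s :* (con 0ℚ :* con 1ℚ) := con 0ℚ) refl (signedInvFact (suc m))) ⟩
      β m + 0ℚ  ≡⟨ +-identityʳ (β m) ⟩
      β m       ∎

  cauchy-T-invFact : ∀ n → cauchy T invFact n ≡ 1ℚ
  cauchy-T-invFact zero    = refl
  cauchy-T-invFact (suc n) = begin
    T 0 * invFact (suc n) + cauchy (T ∘ suc) invFact n
      ≡⟨ cong (λ z → T 0 * invFact (suc n) + z) (trans (cauchy-cong n T-suc (λ _ → refl)) (cauchy-+ˡ n T (signedInvFact ∘ suc) invFact)) ⟩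
    T 0 * invFact (suc n) + (cauchy T invFact n + C)
      ≡⟨ solve 3 (λ a q c → a :+ (q :+ c) := q :+ (a :+ c)) refl (T 0 * invFact (suc n)) (cauchy T invFact n) C ⟩
    cauchy T invFact n + (signedInvFact 0 * invFact (suc n) + C)
      ≡⟨ cong₂ _+_ (cauchy-T-invFact n) (cauchy-signedInvFact-invFact n) ⟩
    1ℚ + 0ℚ ≡⟨ +-identityʳ 1ℚ ⟩
    1ℚ ∎
    where
    open ≡-Reasoning
    C = cauchy (signedInvFact ∘ suc) invFact n

  psum : (ℕ → ℚ) → ℕ → ℚ
  psum f zero    = f 0
  psum f (suc K) = f 0 + psum (f ∘ suc) K

  psum-suc : ∀ K (f : ℕ → ℚ) → psum f (suc K) ≡ psum f K + f (suc K)
  psum-suc zero    f = refl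
  psum-suc (suc K) f rewrite psum-suc K (f ∘ suc) = sym (+-assoc (f 0) (psum (f ∘ suc) K) (f (suc (suc K))))

  S≡psum : ∀ K → S K ≡ psum invFact K
  S≡psum zero    = refl
  S≡psum (suc K) = trans (cong (_+ invFact (suc K)) (S≡psum K)) (sym (psum-suc K invFact))

  cauchy-nonNeg : ∀ n (f g : ℕ → ℚ) → (∀ i → 0ℚ ≤ f i) → (∀ j → 0ℚ ≤ g j) → 0ℚ ≤ cauchy f g n
  cauchy-nonNeg zero    f g f≥0 g≥0 = *-nonNeg (f≥0 0) (g≥0 0)
  cauchy-nonNeg (suc n) f g f≥0 g≥0 = +-mono-≤ (*-nonNeg (f≥0 0) (g≥0 (suc n))) (cauchy-nonNeg n (f ∘ suc) g (f≥0 ∘ suc) g≥0)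

  cauchy-head : ∀ n (f g : ℕ → ℚ) → (∀ i → 0ℚ ≤ f i) → (∀ j → 0ℚ ≤ g j) → f 0 * g n ≤ cauchy f g n
  cauchy-head zero    f g f≥0 g≥0 = ≤-refl
  cauchy-head (suc n) f g f≥0 g≥0 = ≤-by-gap (cauchy (f ∘ suc) g n) refl (cauchy-nonNeg n (f ∘ suc) g (f≥0 ∘ suc) g≥0)

  cauchy≤psum : ∀ n (f g : ℕ → ℚ) → (∀ i → 0ℚ ≤ f i) → (∀ j → g j ≤ 1ℚ) → cauchy f g n ≤ psum f n
  cauchy≤psum zero    f g f≥0 g≤1 = subst (f 0 * g 0 ≤_) (*-identityʳ (f 0)) (*-monoˡ-≤-of-nonNeg (f≥0 0) (g≤1 0))
  cauchy≤psum (suc n) f g f≥0 g≤1 = +-mono-≤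
    (subst (f 0 * g (suc n) ≤_) (*-identityʳ (f 0)) (*-monoˡ-≤-of-nonNeg (f≥0 0) (g≤1 (suc n))))
    (cauchy≤psum n (f ∘ suc) g (f≥0 ∘ suc) g≤1)

  cauchy+head≤ : ∀ m (f g : ℕ → ℚ) → (∀ i → 0ℚ ≤ f i) → (∀ j → g j ≤ 1ℚ) → cauchy f g m + f 0 ≤ f 0 * g m + psum f m
  cauchy+head≤ zero    f g f≥0 g≤1 = ≤-refl
  cauchy+head≤ (suc m) f g f≥0 g≤1 = begin
    f 0 * g (suc m) + cauchy (f ∘ suc) g m + f 0    ≡⟨ +-assoc (f 0 * g (suc m)) _ (f 0) ⟩
    f 0 * g (suc m) + (cauchy (f ∘ suc) g m + f 0)  ≤⟨ +-monoʳ-≤ (f 0 * g (suc m)) (+-monoˡ-≤ (f 0) (cauchy≤psum m (f ∘ suc) g (f≥0 ∘ suc) g≤1)) ⟩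
    f 0 * g (suc m) + (psum (f ∘ suc) m + f 0)      ≡⟨ cong (λ z → f 0 * g (suc m) + z) (+-comm (psum (f ∘ suc) m) (f 0)) ⟩
    f 0 * g (suc m) + psum f (suc m)                ∎
    where open ≤-Reasoning

  cauchy-lower : ∀ K m c (f g : ℕ → ℚ) → (∀ L → c ≤ g (m ℕ.+ L)) → (∀ j → 0ℚ ≤ g j) → (∀ i → 0ℚ ≤ f i) →
    c * psum f K ≤ cauchy f g (K ℕ.+ m)
  cauchy-lower zero m c f g c≤g g≥0 f≥0 = begin
    c * f 0      ≡⟨ *-comm c (f 0) ⟩
    f 0 * c      ≤⟨ *-monoˡ-≤-of-nonNeg (f≥0 0) (subst (c ≤_) (cong g (ℕ.+-identityʳ m)) (c≤g 0)) ⟩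
    f 0 * g m    ≤⟨ cauchy-head m f g f≥0 g≥0 ⟩
    cauchy f g m ∎
    where open ≤-Reasoning
  cauchy-lower (suc K) m c f g c≤g g≥0 f≥0 = begin
    c * (f 0 + psum (f ∘ suc) K)
      ≡⟨ solve 3 (λ c a P → c :* (a :+ P) := a :* c :+ c :* P) refl c (f 0) (psum (f ∘ suc) K) ⟩
    f 0 * c + c * psum (f ∘ suc) K
      ≤⟨ +-mono-≤ (*-monoˡ-≤-of-nonNeg (f≥0 0) (subst (c ≤_) (cong g (+-suc-comm m K)) (c≤g (suc K))))
                  (cauchy-lower K m c (f ∘ suc) g c≤g g≥0 (f≥0 ∘ suc)) ⟩
    f 0 * g (suc (K ℕ.+ m)) + cauchy (f ∘ suc) g (K ℕ.+ m) ∎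
    where open ≤-Reasoning

  cauchy-upper : ∀ K m c (f g : ℕ → ℚ) → (∀ L → g (m ℕ.+ L) ≤ c) → (∀ j → g j ≤ 1ℚ) → (∀ i → 0ℚ ≤ f i) →
    cauchy f g (K ℕ.+ m) + psum f K ≤ c * psum f K + psum f (K ℕ.+ m)
  cauchy-upper zero m c f g g≤c g≤1 f≥0 = begin
    cauchy f g m + f 0    ≤⟨ cauchy+head≤ m f g f≥0 g≤1 ⟩
    f 0 * g m + psum f m  ≤⟨ +-monoˡ-≤ (psum f m) (*-monoˡ-≤-of-nonNeg (f≥0 0) (subst (_≤ c) (cong g (ℕ.+-identityʳ m)) (g≤c 0))) ⟩
    f 0 * c + psum f m    ≡⟨ cong (_+ psum f m) (*-comm (f 0) c) ⟩
    c * f 0 + psum f m    ∎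
    where open ≤-Reasoning
  cauchy-upper (suc K) m c f g g≤c g≤1 f≥0 = begin
    (a * g (suc (K ℕ.+ m)) + cauchy (f ∘ suc) g (K ℕ.+ m)) + (a + P)
      ≡⟨ solve 4 (λ x y a P → (x :+ y) :+ (a :+ P) := (x :+ a) :+ (y :+ P)) refl (a * g (suc (K ℕ.+ m))) (cauchy (f ∘ suc) g (K ℕ.+ m)) a P ⟩
    (a * g (suc (K ℕ.+ m)) + a) + (cauchy (f ∘ suc) g (K ℕ.+ m) + P)
      ≤⟨ +-mono-≤ (+-monoˡ-≤ a (*-monoˡ-≤-of-nonNeg (f≥0 0) (subst (_≤ c) (cong g (+-suc-comm m K)) (g≤c (suc K)))))
                  (cauchy-upper K m c (f ∘ suc) g g≤c g≤1 (f≥0 ∘ suc)) ⟩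
    (a * c + a) + (c * P + Y)
      ≡⟨ solve 4 (λ a c P Y → (a :* c :+ a) :+ (c :* P :+ Y) := c :* (a :+ P) :+ (a :+ Y)) refl a c P Y ⟩
    c * (a + P) + (a + Y) ∎
    where
    open ≤-Reasoning
    a = f 0
    P = psum (f ∘ suc) K
    Y = psum (f ∘ suc) (K ℕ.+ m)

  -- T m - 1 / (m + 1)! ≤ 1 / e ≤ T m + 1 / (m + 1)!, in the two forms in which the partial sums of e can witness it.
  S*[T-invFact]≤1 : ∀ m K → S K * (T m - invFact (suc m)) ≤ 1ℚ
  S*[T-invFact]≤1 m K = begin
    S K * (T m - e)               ≡⟨ trans (cong (_* (T m - e)) (S≡psum K)) (*-comm (psum invFact K) (T m - e)) ⟩
    (T m - e) * psum invFact K    ≤⟨ cauchy-lower K m (T m - e) invFact T (proj₁ ∘ T-near m) T-nonNeg invFact-nonNeg ⟩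
    cauchy invFact T (K ℕ.+ m)    ≡⟨ cauchy-comm (K ℕ.+ m) invFact T ⟩
    cauchy T invFact (K ℕ.+ m)    ≡⟨ cauchy-T-invFact (K ℕ.+ m) ⟩
    1ℚ                            ∎
    where
    open ≤-Reasoning
    e = invFact (suc m)

  1+S≤[T+invFact]*S+S : ∀ n K → 1ℚ + S K ≤ (T n + invFact (suc n)) * S K + S (K ℕ.+ n)
  1+S≤[T+invFact]*S+S n K = begin
    1ℚ + S K                                        ≡⟨ cong₂ _+_ (sym (cauchy-T-invFact (K ℕ.+ n))) (S≡psum K) ⟩
    cauchy T invFact (K ℕ.+ n) + psum invFact K     ≡⟨ cong (_+ psum invFact K) (cauchy-comm (K ℕ.+ n) T invFact) ⟩
    cauchy invFact T (K ℕ.+ n) + psum invFact K     ≤⟨ cauchy-upper K n (T n + e) invFact T (proj₂ ∘ T-near n) T≤1 invFact-nonNeg ⟩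
    (T n + e) * psum invFact K + psum invFact (K ℕ.+ n)
                                                    ≡⟨ cong₂ (λ x y → (T n + e) * x + y) (sym (S≡psum K)) (sym (S≡psum (K ℕ.+ n))) ⟩
    (T n + e) * S K + S (K ℕ.+ n)                   ∎
    where
    open ≤-Reasoning
    e = invFact (suc n)

  <⇒+1≤ : ∀ {i j} → i ℤ.< j → (i ℤ.+ + 1) / 1 ≤ j / 1
  <⇒+1≤ {i} {j} i<j = /1-mono-≤ (subst (ℤ._≤ j) (ℤ.+-comm (+ 1) i) (ℤ.i<j⇒suc[i]≤j i<j))

  upper-closed⇒floor-unique : ∀ (P : ℚ → Set) → (∀ {q q′} → P q → q ≤ q′ → P q′) → ∀ {a a′} →
    ¬ P (a / 1) × P ((a ℤ.+ + 1) / 1) → ¬ P (a′ / 1) × P ((a′ ℤ.+ + 1) / 1) → a ≡ a′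
  upper-closed⇒floor-unique P closed {a} {a′} (¬Pa , Pa+1) (¬Pa′ , Pa′+1) with ℤ.<-cmp a a′
  ... | tri< a<a′ _ _ = ⊥-elim (¬Pa′ (closed Pa+1 (<⇒+1≤ a<a′)))
  ... | tri≈ _ a≡a′ _ = a≡a′
  ... | tri> _ _ a′<a = ⊥-elim (¬Pa (closed Pa′+1 (<⇒+1≤ a′<a)))

  MulELt-mono : ∀ {c q q′} → MulELt c q → q ≤ q′ → MulELt c q′
  MulELt-mono (ε , ε>0 , bound) q≤q′ = ε , ε>0 , λ K → ≤-trans (bound K) q≤q′

  AffEinvLt-mono : ∀ {A c q q′} → AffEinvLt A c q → q ≤ q′ → AffEinvLt A c q′
  AffEinvLt-mono {A} {c} (t>0 , K , c<) q≤q′ = <-≤-trans t>0 t≤t′ , K , <-≤-trans c< (*-monoˡ-≤-of-nonNeg (S-nonNeg K) t≤t′)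
    where t≤t′ = +-monoˡ-≤ (- (A * c)) q≤q′

  IsFloorMulE-unique : ∀ {c a a′} → IsFloorMulE c a → IsFloorMulE c a′ → a ≡ a′
  IsFloorMulE-unique {c} = upper-closed⇒floor-unique (MulELt c) MulELt-mono

  IsFloorAffEinv-unique : ∀ {A c z z′} → IsFloorAffEinv A c z → IsFloorAffEinv A c z′ → z ≡ z′
  IsFloorAffEinv-unique {A} {c} = upper-closed⇒floor-unique (AffEinvLt A c) (AffEinvLt-mono {A} {c})

  eUpper*fromℕ! : ∀ N → eUpper N * fromℕ (suc N !) ≡ fromℕ (scaledS (suc N)) + recip (suc N)
  eUpper*fromℕ! N = begin
    (S (suc N) + e * r) * c      ≡⟨ solve 4 (λ s e r c → (s :+ e :* r) :* c := s :* c :+ (e :* c) :* r) refl (S (suc N)) e r c ⟩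
    S (suc N) * c + (e * c) * r  ≡⟨ cong₂ (λ x y → x + y * r) (S*fromℕ! (suc N)) (invFact-inverse (suc N)) ⟩
    fromℕ (scaledS (suc N)) + 1ℚ * r  ≡⟨ cong (λ z → fromℕ (scaledS (suc N)) + z) (*-identityˡ r) ⟩
    fromℕ (scaledS (suc N)) + r  ∎
    where
    open ≡-Reasoning
    e = invFact (suc N)
    r = recip (suc N)
    c = fromℕ (suc N !)

  floor-e*! : ∀ N → 2 ℕ.≤ N → IsFloorMulE (fromℕ (N !)) (+ scaledS N)
  floor-e*! (suc N) (ℕ.s≤s 1≤N) = not-below , below
    where
    s = fromℕ (scaledS (suc N))
    c = fromℕ (suc N !)
    not-below : ¬ MulELt c s
    not-below (ε , ε>0 , bound) =
      <-irrefl refl (<-≤-trans (<-by-gap ε refl ε>0) (subst (λ z → z + ε ≤ s) (S*fromℕ! (suc N)) (bound (suc N))))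
    below : MulELt c (fromℕ (scaledS (suc N) ℕ.+ 1))
    below = recip 2 , recip-pos 2 (ℕ.s≤s ℕ.z≤n) , λ K → begin
      S K * c + recip 2                     ≤⟨ +-monoˡ-≤ (recip 2) (*-monoʳ-≤-of-nonNeg (fromℕ-nonNeg (suc N !)) (S≤eUpper K N)) ⟩
      eUpper N * c + recip 2                ≡⟨ cong (_+ recip 2) (eUpper*fromℕ! N) ⟩
      s + recip (suc N) + recip 2           ≤⟨ +-monoˡ-≤ (recip 2) (+-monoʳ-≤ s (recip-antitone (ℕ.s≤s 1≤N))) ⟩
      s + recip 2 + recip 2                 ≡⟨ +-assoc s (recip 2) (recip 2) ⟩
      s + 1ℚ                                ≡⟨ fromℕ-+ (scaledS (suc N)) 1 ⟨
      fromℕ (scaledS (suc N) ℕ.+ 1)         ∎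
      where open ≤-Reasoning

  Apart-eUpper : ∀ N → div (+ scaledS N) (N !) + div (+ suc (suc N)) (suc N ℕ.* suc N !) ≡ eUpper N
  Apart-eUpper N = begin
    div (+ scaledS N) (N !) + div (+ suc (suc N)) (suc N ℕ.* suc N !)
      ≡⟨ cong₂ _+_ (div-unique (+ scaledS N) (N !) (S N) (ℕ.1≤n! N) (S*fromℕ! N))
                   (div-unique (+ suc (suc N)) (suc N ℕ.* suc N !) (e + e * r) (ℕ.*-mono-≤ {1} {suc N} {1} {suc N !} (ℕ.s≤s ℕ.z≤n) (ℕ.1≤n! (suc N))) last-term) ⟩
    S N + (e + e * r)  ≡⟨ +-assoc (S N) e (e * r) ⟨
    eUpper N           ∎
    where
    open ≡-Reasoning
    e = invFact (suc N)
    r = recip (suc N)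
    a = fromℕ (suc N)
    f = fromℕ (suc N !)
    last-term : (e + e * r) * fromℕ (suc N ℕ.* suc N !) ≡ + suc (suc N) / 1
    last-term = begin
      (e + e * r) * fromℕ (suc N ℕ.* suc N !)  ≡⟨ cong ((e + e * r) *_) (fromℕ-* (suc N) (suc N !)) ⟩
      (e + e * r) * (a * f)                    ≡⟨ solve 4 (λ e r a f → (e :+ e :* r) :* (a :* f) := (e :* f) :* a :+ (e :* f) :* (r :* a)) refl e r a f ⟩
      (e * f) * a + (e * f) * (r * a)          ≡⟨ cong₂ (λ x y → x * a + x * y) (invFact-inverse (suc N)) (recip-inverse (suc N) (ℕ.s≤s ℕ.z≤n)) ⟩
      1ℚ * a + 1ℚ * 1ℚ                         ≡⟨ cong (_+ 1ℚ) (*-identityˡ a) ⟩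
      a + 1ℚ                                   ≡⟨ +-comm a 1ℚ ⟩
      1ℚ + a                                   ≡⟨ fromℕ-+ 1 (suc N) ⟨
      fromℕ (suc (suc N))                      ∎

  invFact-suc*fromℕ! : ∀ k → invFact (suc k) * fromℕ (k !) ≡ recip (suc k)
  invFact-suc*fromℕ! k = *-cancelʳ-inverse (trans (*-comm (fromℕ (suc k)) (recip (suc k))) (recip-inverse (suc k) (ℕ.s≤s ℕ.z≤n))) (begin
    invFact (suc k) * fromℕ (k !) * fromℕ (suc k)      ≡⟨ solve 3 (λ e a b → e :* a :* b := e :* (b :* a)) refl (invFact (suc k)) (fromℕ (k !)) (fromℕ (suc k)) ⟩
    invFact (suc k) * (fromℕ (suc k) * fromℕ (k !))    ≡⟨ cong (invFact (suc k) *_) (fromℕ-* (suc k) (k !)) ⟨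
    invFact (suc k) * fromℕ (suc k !)                  ≡⟨ invFact-inverse (suc k) ⟩
    1ℚ                                                 ≡⟨ recip-inverse (suc k) (ℕ.s≤s ℕ.z≤n) ⟨
    recip (suc k) * fromℕ (suc k)                      ∎)
    where open ≡-Reasoning

  S-suc*fromℕ! : ∀ n → S (suc n) * fromℕ (n !) ≡ fromℕ (scaledS n) + recip (suc n)
  S-suc*fromℕ! n = trans (*-distribʳ-+ (fromℕ (n !)) (S n) (invFact (suc n))) (cong₂ _+_ (S*fromℕ! n) (invFact-suc*fromℕ! n))

  -- T n + tailSlack n is (D n + 1 - r - r²) / n! with r = 1 / (n + 1); it exceeds 1 / e for n ≥ 2.
  tailSlack : ℕ → ℚ
  tailSlack n = invFact n - invFact (suc n) - invFact (suc n) * recip (suc n)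

  tailSlack-excess : ∀ n → 2 ℕ.≤ n → 0ℚ < tailSlack n - invFact (suc n) - invFact (suc n) * recip (suc n)
  tailSlack-excess n 2≤n = subst (0ℚ <_) (sym excess≡) (*-pos (invFact-pos (suc n)) (<-≤-trans (toWitness {a? = 0ℚ <? w₀} tt) w₀≤w))
    where
    e = invFact (suc n)
    r = recip (suc n)
    a = fromℕ (suc n)
    w = a - (fromℕ 2 + (r + r))
    w₀ = fromℕ 3 - (fromℕ 2 + (recip 3 + recip 3))
    r≤ : r ≤ recip 3
    r≤ = recip-antitone (ℕ.s≤s 2≤n)
    w₀≤w : w₀ ≤ w
    w₀≤w = +-mono-≤ (fromℕ-mono-≤ (ℕ.s≤s 2≤n)) (neg-antimono-≤ (+-monoʳ-≤ (fromℕ 2) (+-mono-≤ r≤ r≤)))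
    excess≡ : tailSlack n - e - e * r ≡ e * w
    excess≡ = begin
      invFact n - e - e * r - e - e * r        ≡⟨ cong (λ z → z - e - e * r - e - e * r) (fromℕ-*-invFact-suc n) ⟨
      a * e - e - e * r - e - e * r            ≡⟨ solve 3 (λ a e r → a :* e :- e :- e :* r :- e :- e :* r := e :* (a :- (con (fromℕ 2) :+ (r :+ r)))) refl a e r ⟩
      e * w                                    ∎
      where open ≡-Reasoning

  1≤[T+invFact]*S+invFact*recip : ∀ n → 1ℚ ≤ (T n + invFact (suc n)) * S (suc n) + invFact (suc n) * recip (suc n)
  1≤[T+invFact]*S+invFact*recip n = subst₂ _≤_ (cancel-s 1ℚ) (cancel-s X) (+-monoˡ-≤ (- s) (begin
    1ℚ + s                         ≤⟨ 1+S≤[T+invFact]*S+S n (suc n) ⟩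
    (T n + e) * s + S (suc n ℕ.+ n) ≤⟨ +-monoʳ-≤ ((T n + e) * s) (S≤eUpper (suc n ℕ.+ n) n) ⟩
    (T n + e) * s + (s + e * r)    ≡⟨ solve 4 (λ a s e r → a :* s :+ (s :+ e :* r) := (a :* s :+ e :* r) :+ s) refl (T n + e) s e r ⟩
    X + s                          ∎))
    where
    open ≤-Reasoning
    s = S (suc n)
    e = invFact (suc n)
    r = recip (suc n)
    X = (T n + e) * s + e * r
    cancel-s : ∀ x → x + s - s ≡ x
    cancel-s x = solve 2 (λ x s → x :+ s :- s := x) refl x s

  1<S*[T+tailSlack] : ∀ n → 2 ℕ.≤ n → 1ℚ < S (suc n) * (T n + tailSlack n)
  1<S*[T+tailSlack] n 2≤n = begin-strict
    1ℚ                                    <⟨ <-by-gap Z refl Z>0 ⟩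
    1ℚ + Z                                ≤⟨ +-monoˡ-≤ Z (1≤[T+invFact]*S+invFact*recip n) ⟩
    (T n + e) * s + e * r + Z             ≡⟨ solve 5 (λ a s e r z → a :* s :+ e :* r :+ (z :- e :- e :* r) := a :* s :+ (z :- e) :* con 1ℚ) refl (T n + e) s e r σ ⟩
    (T n + e) * s + (σ - e) * 1ℚ          ≤⟨ +-monoʳ-≤ ((T n + e) * s) (*-monoˡ-≤-of-nonNeg σ-e≥0 (1≤S (suc n))) ⟩
    (T n + e) * s + (σ - e) * s           ≡⟨ solve 4 (λ t e s z → (t :+ e) :* s :+ (z :- e) :* s := s :* (t :+ z)) refl (T n) e s σ ⟩
    s * (T n + σ)                         ∎
    where
    open ≤-Reasoning
    s = S (suc n)
    e = invFact (suc n)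
    r = recip (suc n)
    σ = tailSlack n
    Z = σ - e - e * r
    Z>0 : 0ℚ < Z
    Z>0 = tailSlack-excess n 2≤n
    σ-e≥0 : 0ℚ ≤ σ - e
    σ-e≥0 = subst (0ℚ ≤_) (solve 3 (λ σ e r → (σ :- e :- e :* r) :+ e :* r := σ :- e) refl σ e r)
      (+-mono-≤ (<⇒≤ Z>0) (*-nonNeg (invFact-nonNeg (suc n)) (<⇒≤ (recip-pos (suc n) (ℕ.s≤s ℕ.z≤n)))))

  fromℕ-D-recip : ∀ n → fromℕ (D n) - recip (suc n) ≡ fromℕ (n !) * (T n - invFact (suc n))
  fromℕ-D-recip n = sym (begin
    c * (d * invFact n - e)                 ≡⟨ solve 4 (λ c d en e → c :* (d :* en :- e) := d :* (c :* en) :- e :* c) refl c d (invFact n) e ⟩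
    d * (c * invFact n) - e * c             ≡⟨ cong₂ (λ x y → d * x - y) (trans (*-comm c (invFact n)) (invFact-inverse n)) (invFact-suc*fromℕ! n) ⟩
    d * 1ℚ - recip (suc n)                  ≡⟨ cong (_- recip (suc n)) (*-identityʳ d) ⟩
    d - recip (suc n)                       ∎)
    where
    open ≡-Reasoning
    c = fromℕ (n !)
    d = fromℕ (D n)
    e = invFact (suc n)

  D+scaledS+1-eUpper*! : ∀ n → fromℕ (D n ℕ.+ scaledS n ℕ.+ 1) - eUpper n * fromℕ (n !) ≡ fromℕ (n !) * (T n + tailSlack n)
  D+scaledS+1-eUpper*! n = trans lhs≡ (sym rhs≡)
    where
    open ≡-Reasoning
    c = fromℕ (n !)
    d = fromℕ (D n)
    s = fromℕ (scaledS n)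
    e = invFact (suc n)
    r = recip (suc n)
    en = invFact n
    lhs≡ : fromℕ (D n ℕ.+ scaledS n ℕ.+ 1) - eUpper n * c ≡ d + 1ℚ - r - r * r
    lhs≡ = begin
      fromℕ (D n ℕ.+ scaledS n ℕ.+ 1) - (S (suc n) + e * r) * c
        ≡⟨ cong₂ (λ x y → x - y) (trans (fromℕ-+ (D n ℕ.+ scaledS n) 1) (cong (_+ 1ℚ) (fromℕ-+ (D n) (scaledS n))))
                                 (solve 4 (λ S e r c → (S :+ e :* r) :* c := S :* c :+ (e :* c) :* r) refl (S (suc n)) e r c) ⟩
      (d + s + 1ℚ) - (S (suc n) * c + (e * c) * r)
        ≡⟨ cong₂ (λ x y → (d + s + 1ℚ) - (x + y * r)) (S-suc*fromℕ! n) (invFact-suc*fromℕ! n) ⟩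
      (d + s + 1ℚ) - (s + r + r * r)
        ≡⟨ solve 3 (λ d s r → (d :+ s :+ con 1ℚ) :- (s :+ r :+ r :* r) := d :+ con 1ℚ :- r :- r :* r) refl d s r ⟩
      d + 1ℚ - r - r * r ∎
    rhs≡ : c * (T n + tailSlack n) ≡ d + 1ℚ - r - r * r
    rhs≡ = begin
      c * (d * en + (en - e - e * r))
        ≡⟨ solve 5 (λ c d en e r → c :* (d :* en :+ (en :- e :- e :* r)) := d :* (c :* en) :+ c :* en :- e :* c :- (e :* c) :* r) refl c d en e r ⟩
      d * (c * en) + c * en - e * c - (e * c) * r
        ≡⟨ cong₂ (λ x y → d * x + x - y - y * r) (trans (*-comm c en) (invFact-inverse n)) (invFact-suc*fromℕ! n) ⟩
      d * 1ℚ + 1ℚ - r - r * r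
        ≡⟨ cong (λ z → z + 1ℚ - r - r * r) (*-identityʳ d) ⟩
      d + 1ℚ - r - r * r ∎

  tailSlack-pos : ∀ n → 2 ℕ.≤ n → 0ℚ < tailSlack n
  tailSlack-pos n 2≤n = <-≤-trans (tailSlack-excess n 2≤n) (≤-by-gap (e + e * r)
    (solve 3 (λ σ e r → σ := (σ :- e :- e :* r) :+ (e :+ e :* r)) refl (tailSlack n) e r)
    (+-mono-≤ (invFact-nonNeg (suc n)) (*-nonNeg (invFact-nonNeg (suc n)) (<⇒≤ (recip-pos (suc n) (ℕ.s≤s ℕ.z≤n))))))
    where
    e = invFact (suc n)
    r = recip (suc n)

  floor-[eUpper+e⁻¹]*! : ∀ n L → 2 ℕ.≤ n → IsFloorAffEinv (eUpper (n ℕ.+ L)) (fromℕ (n !)) (+ (D n ℕ.+ scaledS n))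
  floor-[eUpper+e⁻¹]*! n L 2≤n = not-below , below
    where
    c = fromℕ (n !)
    u = eUpper (n ℕ.+ L)
    e = invFact (suc n)
    q₀ = fromℕ (D n ℕ.+ scaledS n)
    q₁ = fromℕ (D n ℕ.+ scaledS n ℕ.+ 1)
    not-below : ¬ AffEinvLt u c q₀
    not-below (_ , K , c<) = <-irrefl refl (<-≤-trans c< (begin
      S K * (q₀ - u * c)      ≤⟨ *-monoˡ-≤-of-nonNeg (S-nonNeg K) (begin
        q₀ - u * c              ≤⟨ +-monoʳ-≤ q₀ (neg-antimono-≤ (*-monoʳ-≤-of-nonNeg (fromℕ-nonNeg (n !)) (S≤eUpper (suc n) (n ℕ.+ L)))) ⟩
        q₀ - S (suc n) * c      ≡⟨ cong₂ _-_ (fromℕ-+ (D n) (scaledS n)) (S-suc*fromℕ! n) ⟩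
        (fromℕ (D n) + fromℕ (scaledS n)) - (fromℕ (scaledS n) + recip (suc n))
                                ≡⟨ solve 3 (λ d s r → (d :+ s) :- (s :+ r) := d :- r) refl (fromℕ (D n)) (fromℕ (scaledS n)) (recip (suc n)) ⟩
        fromℕ (D n) - recip (suc n) ≡⟨ fromℕ-D-recip n ⟩
        c * (T n - e)           ∎) ⟩
      S K * (c * (T n - e))   ≡⟨ solve 3 (λ a c x → a :* (c :* x) := c :* (a :* x)) refl (S K) c (T n - e) ⟩
      c * (S K * (T n - e))   ≤⟨ *-monoˡ-≤-of-nonNeg (fromℕ-nonNeg (n !)) (S*[T-invFact]≤1 n K) ⟩
      c * 1ℚ                  ≡⟨ *-identityʳ c ⟩
      c                       ∎))
      where open ≤-Reasoning
    σ = tailSlack n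
    t₁≥ : c * (T n + σ) ≤ q₁ - u * c
    t₁≥ = begin
      c * (T n + σ)           ≡⟨ D+scaledS+1-eUpper*! n ⟨
      q₁ - eUpper n * c       ≤⟨ +-monoʳ-≤ q₁ (neg-antimono-≤ (*-monoʳ-≤-of-nonNeg (fromℕ-nonNeg (n !)) (eUpper-antitone n L))) ⟩
      q₁ - u * c              ∎
      where open ≤-Reasoning
    c>0 : 0ℚ < c
    c>0 = <-≤-trans (fromℕ-pos 0) (fromℕ-mono-≤ (ℕ.1≤n! n))
    below : AffEinvLt u c q₁
    below = <-≤-trans (*-pos c>0 (+-mono-≤-< (T-nonNeg n) (tailSlack-pos n 2≤n))) t₁≥ , suc n , (begin-strict
      c                              ≡⟨ *-identityʳ c ⟨
      c * 1ℚ                         <⟨ *-monoʳ-<-pos c {{positive c>0}} (1<S*[T+tailSlack] n 2≤n) ⟩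
      c * (S (suc n) * (T n + σ))    ≡⟨ solve 3 (λ c a x → c :* (a :* x) := a :* (c :* x)) refl c (S (suc n)) (T n + σ) ⟩
      S (suc n) * (c * (T n + σ))    ≤⟨ *-monoˡ-≤-of-nonNeg (S-nonNeg (suc n)) t₁≥ ⟩
      S (suc n) * (q₁ - u * c)       ∎)
      where open ≤-Reasoning

  Apart≡eUpper : ∀ n m → 2 ℕ.≤ n ℕ.+ m → Apart n m (+ scaledS (n ℕ.+ m ℕ.∸ 2)) ≡ eUpper (n ℕ.+ m ℕ.∸ 2)
  Apart≡eUpper n m 2≤n+m = at (n ℕ.+ m) 2≤n+m
    where
    at : ∀ p → 2 ℕ.≤ p → div (+ scaledS (p ℕ.∸ 2)) ((p ℕ.∸ 2) !) + div (+ p) ((p ℕ.∸ 1) ℕ.* (p ℕ.∸ 1) !) ≡ eUpper (p ℕ.∸ 2)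
    at (suc (suc N)) _ = Apart-eUpper N
    at (suc zero) (ℕ.s≤s ())

open SeriesBounds using (scaledS; eUpper; floor-e*!; floor-[eUpper+e⁻¹]*!; Apart≡eUpper; IsFloorMulE-unique; IsFloorAffEinv-unique)

open import Data.Nat using (ℕ; _≤_; _!)
open import Data.Nat using () renaming (_+_ to _+ℕ_; _∸_ to _∸ℕ_)
open import Data.Integer using (ℤ; +_; _+_)
open import Data.Rational using (_/_)
open import Data.Product using (Σ; _×_; _,_)
open import Relation.Binary.PropositionalEquality using (_≡_; refl; sym; subst)
import Data.Nat.Properties as ℕ

theorem6 : (m n : ℕ) → 3 ≤ m → 2 ≤ n →
    (Σ ℤ λ a → Σ ℤ λ b → Σ ℤ λ z →
        IsFloorMulE (+ ((n +ℕ m ∸ℕ 2) !) / 1) a × IsFloorMulE (+ (n !) / 1) b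
        × IsFloorAffEinv (Apart n m a) (+ (n !) / 1) z)
    × (∀ (a b z : ℤ) → IsFloorMulE (+ ((n +ℕ m ∸ℕ 2) !) / 1) a → IsFloorMulE (+ (n !) / 1) b →
        IsFloorAffEinv (Apart n m a) (+ (n !) / 1) z → + D n + b ≡ z)
theorem6 m n 3≤m 2≤n = (a₀ , b₀ , z₀ , floor-a , floor-b , floor-z) , unique
  where
  N = n +ℕ m ∸ℕ 2
  c = + (n !) / 1
  N≡n+[m∸2] : N ≡ n +ℕ (m ∸ℕ 2)
  N≡n+[m∸2] = ℕ.+-∸-assoc n (ℕ.≤-trans (ℕ.n≤1+n 2) 3≤m)
  a₀ = + scaledS N
  b₀ = + scaledS n
  z₀ = + D n + b₀
  floor-a : IsFloorMulE (+ (N !) / 1) a₀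
  floor-a = floor-e*! N (subst (2 ≤_) (sym N≡n+[m∸2]) (ℕ.≤-trans 2≤n (ℕ.m≤m+n n (m ∸ℕ 2))))
  floor-b : IsFloorMulE c b₀
  floor-b = floor-e*! n 2≤n
  floor-z : IsFloorAffEinv (Apart n m a₀) c z₀
  floor-z = subst (λ A → IsFloorAffEinv A c z₀) (sym (Apart≡eUpper n m (ℕ.≤-trans 2≤n (ℕ.m≤m+n n m))))
    (subst (λ N → IsFloorAffEinv (eUpper N) c z₀) (sym N≡n+[m∸2]) (floor-[eUpper+e⁻¹]*! n (m ∸ℕ 2) 2≤n))
  unique : ∀ a b z → IsFloorMulE (+ (N !) / 1) a → IsFloorMulE c b → IsFloorAffEinv (Apart n m a) c z → + D n + b ≡ z
  unique a b z floor-a′ floor-b′ floor-z′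
    with refl ← IsFloorMulE-unique {a = a} {a₀} floor-a′ floor-a | refl ← IsFloorMulE-unique {a = b} {b₀} floor-b′ floor-b =
    IsFloorAffEinv-unique {Apart n m a₀} {c} {z₀} {z} floor-z floor-z′
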